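{- Let $c\ge1$, $0\le k\le n$ and $\sigma\in D_k^{(c)}$. Then $$\sum_{\substack{\pi\in G_{c,n}\\ dp(\pi)=\sigma}} q^{fmaj(\pi)}=q^{fmaj(\sigma)}{n \brack k}_{q^c},$$ where ${n \brack k}_{x}=\frac{[n]_x!}{[k]_x!\,[n-k]_x!}$.
   Context: For positive integers $c,n$, $G_{c,n}$ is the set of colored permutations $\pi=\pi_1^{[t_1]}\cdots\pi_n^{[t_n]}$ with $\pi_1\cdots\pi_n$ a permutation of $[n]$ and colors $t_i\in\{0,\dots,c-1\}$; $col(\pi)=\sum_it_i$. A fixed point of $\pi$ is an index $i$ with $\pi_i=i$ and $t_i=0$. $D_k^{(c)}\subseteq G_{c,k}$ is the set of colored derangements, i.e. elements with no fixed point ($D_0^{(c)}$ consists of the empty word, with $fmaj=0$). The derangement part $dp(\pi)$ of $\pi\in G_{c,n}$: let $j_1<\dots<j_k$ be the non-fixed positions, and $a_1<\dots<a_k$ the set $\{\pi_{j_1},\dots,\pi_{j_k}\}$; $dp(\pi)\in D_k^{(c)}$ is obtained from the subword $\pi_{j_1}^{[t_{j_1}]}\cdots\pi_{j_k}^{[t_{j_k}]}$ by replacing each letter $a_i^{[r]}$ by $i^{[r]}$. Order colored letters by $1^{[c-1]}<\cdots<n^{[c-1]}<\cdots<1^{[1]}<\cdots<n^{[1]}<1<\cdots<n$; $Des_c(\pi)=\{i:\pi_i^{[t_i]}>\pi_{i+1}^{[t_{i+1}]}\}$ in this order, $maj(\pi)=\sum_{i\in Des_c(\pi)}i$, $fmaj(\pi)=c\cdot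 maj(\pi)+col(\pi)$. Here $[m]_x=1+x+\cdots+x^{m-1}$ and $[m]_x!=[1]_x[2]_x\cdots[m]_x$, $[0]_x!=1$. -}

module Defs where

open import Data.Bool using (Bool; true; false; _∧_; _∨_; not; if_then_else_)
open import Data.Nat using (ℕ; zero; suc; _+_; _*_; _∸_; _≡ᵇ_; _<ᵇ_)
open import Data.Product using (_×_; _,_; proj₁; proj₂)
open import Data.Nat.ListAction using (sum)
open import Data.List using (List; []; _∷_; map; length; filterᵇ; concatMap; upTo; applyUpTo)

-- Colored letters and colored words.
-- A colored letter a^[t] is the pair (a , t); a colored word is a list of
-- colored letters.  Values are the positive integers 1..n.

Letter : Set
Letter = ℕ × ℕ

Word : Set
Word = List Letter

val : Letter → ℕ
val = proj₁

color : Letter → ℕ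
color = proj₂

_==L_ : Letter → Letter → Bool
(a , t) ==L (b , s) = (a ≡ᵇ b) ∧ (t ≡ᵇ s)

_==W_ : Word → Word → Bool
[] ==W [] = true
(x ∷ xs) ==W (y ∷ ys) = (x ==L y) ∧ (xs ==W ys)
_ ==W _ = false

-- The set G_{c,n}, as an explicit list: all words of length n with letters
-- a^[t], 1 ≤ a ≤ n, 0 ≤ t < c, whose underlying values are pairwise distinct
-- (i.e. a permutation of [n]).

words : List Letter → ℕ → List Word
words alph zero = [] ∷ []
words alph (suc m) = concatMap (λ x → map (x ∷_) (words alph m)) alph

letters : ℕ → ℕ → List Letter
letters c n = concatMap (λ a → map (λ t → (suc a , t)) (upTo c)) (upTo n)

notElem : ℕ → List ℕ → Bool
notElem a [] = true
notElem a (b ∷ bs) = not (a ≡ᵇ b) ∧ notElem a bs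

distinct : List ℕ → Bool
distinct [] = true
distinct (a ∷ as) = notElem a as ∧ distinct as

G : ℕ → ℕ → List Word
G c n = filterᵇ (λ w → distinct (map val w)) (words (letters c n) n)

-- isFixed i x : letter x at (1-based) position i is a fixed point
isFixed : ℕ → Letter → Bool
isFixed i (a , t) = (a ≡ᵇ i) ∧ (t ≡ᵇ 0)

indexedFrom : ℕ → Word → List (ℕ × Letter)
indexedFrom i [] = []
indexedFrom i (x ∷ xs) = (i , x) ∷ indexedFrom (suc i) xs

hasNoFixed : Word → Bool
hasNoFixed w = length (filterᵇ (λ p → isFixed (proj₁ p) (proj₂ p)) (indexedFrom 1 w)) ≡ᵇ 0

-- D_k^{(c)} as an explicit list (for k = 0 it is the list containing the empty word)
D : ℕ → ℕ → List Word
D c k = filterᵇ hasNoFixed (G c k)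

nonFixed : Word → Word
nonFixed w = map proj₂ (filterᵇ (λ p → not (isFixed (proj₁ p) (proj₂ p))) (indexedFrom 1 w))

rank : ℕ → List ℕ → ℕ
rank a vs = suc (length (filterᵇ (λ b → b <ᵇ a) vs))

standardize : Word → Word
standardize u = map (λ x → (rank (val x) (map val u) , color x)) u

dp : Word → Word
dp w = standardize (nonFixed w)

-- Order on colored letters, descents, maj, col, fmaj.
-- 1^[c-1] < ... < n^[c-1] < ... < 1^[1] < ... < n^[1] < 1 < ... < n :
-- a^[t] < b^[s]  iff  t > s, or t = s and a < b.

_<L_ : Letter → Letter → Bool
(a , t) <L (b , s) = (s <ᵇ t) ∨ ((t ≡ᵇ s) ∧ (a <ᵇ b))

majFrom : ℕ → Word → ℕ
majFrom i [] = 0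
majFrom i (x ∷ []) = 0
majFrom i (x ∷ y ∷ ys) = (if y <L x then i else 0) + majFrom (suc i) (y ∷ ys)

maj : Word → ℕ
maj = majFrom 1

col : Word → ℕ
col w = sum (map color w)

fmaj : ℕ → Word → ℕ
fmaj c w = c * maj w + col w

-- Polynomials in q with natural-number coefficients, represented by their
-- coefficient functions (coefficient of q^m).

Poly : Set
Poly = ℕ → ℕ

_⊕_ : Poly → Poly → Poly
(f ⊕ g) m = f m + g m

_⊗_ : Poly → Poly → Poly
(f ⊗ g) m = sum (map (λ i → f i * g (m ∸ i)) (upTo (suc m)))

mono : ℕ → Poly
mono e m = if m ≡ᵇ e then 1 else 0

one : Poly
one = mono 0

qint : ℕ → ℕ → Poly
qint c zero = λ _ → 0
qint c (suc m) = qint c m ⊕ mono (c * m)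

qfact : ℕ → ℕ → Poly
qfact c zero = one
qfact c (suc m) = qfact c m ⊗ qint c (suc m)

-- Σ_{π ∈ G_{c,n}, dp(π) = σ} q^{fmaj(π)} :
-- coefficient of q^m = #{π ∈ G_{c,n} : dp(π) = σ, fmaj(π) = m}
dpGen : ℕ → ℕ → Word → Poly
dpGen c n σ m = length (filterᵇ (λ π → (dp π ==W σ) ∧ (fmaj c π ≡ᵇ m)) (G c n))

-- A colored permutation π with dp π = σ is determined by the positions of its fixed points: it is σ,
-- relabelled increasingly onto the other positions, with i^[0] placed at each fixed position i.
-- Recording the fixed positions as a mask with k falses and n - k trues is a bijection from the
-- fibre of σ onto all such masks, and it leaves the colors unchanged. By Wachs' observation,
-- whether a fixed point forms a descent with a neighbouring letter depends only on whether that
-- letter is an excedance of σ, so maj π is the major index of a word of tokens: the letters of σ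
-- marked by excedance, shuffled with r = n - k fixed-point tokens. Summing q^(c maj) over these
-- shuffles according to the last token reproduces the q^c-Pascal recurrence of the Gaussian
-- coefficient, which gives q^(fmaj σ) [n choose k]_(q^c); multiplying by [k]! [n-k]! in q^c
-- clears the denominators.
module Submission where

open import Defs
open import Data.Nat using (ℕ; _≤_; _∸_)
open import Data.List.Membership.Propositional using (_∈_)
open import Relation.Binary.PropositionalEquality using (_≡_)

module Comparisons where

  open import Data.Bool.Base using (true; false; not; T)
  open import Data.Nat.Base using (ℕ; zero; suc; _<_; _≤_; _<ᵇ_; _≡ᵇ_)
  open import Data.Nat.Properties
  open import Relation.Binary.Definitions using (tri<; tri≈; tri>)
  open import Relation.Binary.PropositionalEquality
  open import Relation.Nullary.Negation using (contradiction)

  T⇒≡true : ∀ {b} → T b → b ≡ true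
  T⇒≡true {true} _ = refl

  ≡true⇒T : ∀ {b} → b ≡ true → T b
  ≡true⇒T refl = _

  ≡ᵇ-comm : ∀ m n → (m ≡ᵇ n) ≡ (n ≡ᵇ m)
  ≡ᵇ-comm zero zero = refl
  ≡ᵇ-comm zero (suc n) = refl
  ≡ᵇ-comm (suc m) zero = refl
  ≡ᵇ-comm (suc m) (suc n) = ≡ᵇ-comm m n

  <ᵇ-true : ∀ {a b} → a < b → (a <ᵇ b) ≡ true
  <ᵇ-true {a} {b} a<b with a <ᵇ b in eq
  ... | true = refl
  ... | false = contradiction (<⇒<ᵇ a<b) (subst T eq)

  <ᵇ-false : ∀ {a b} → b ≤ a → (a <ᵇ b) ≡ false
  <ᵇ-false {a} {b} b≤a with a <ᵇ b in eq
  ... | false = refl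
  ... | true = contradiction (<ᵇ⇒< a b (subst T (sym eq) _)) (≤⇒≯ b≤a)

  <ᵇ-true⁻ : ∀ {a b} → (a <ᵇ b) ≡ true → a < b
  <ᵇ-true⁻ {a} {b} eq = <ᵇ⇒< a b (subst T (sym eq) _)

  <ᵇ-false⁻ : ∀ {a b} → (a <ᵇ b) ≡ false → b ≤ a
  <ᵇ-false⁻ {a} {b} eq = ≮⇒≥ (λ a<b → subst T eq (<⇒<ᵇ a<b))

  <ᵇ-cmp : ∀ {a b c d} → (a < b → c < d) → (b ≤ a → d ≤ c) → (a <ᵇ b) ≡ (c <ᵇ d)
  <ᵇ-cmp {a} {b} a<b⇒c<d b≤a⇒d≤c with a <ᵇ b in eq
  ... | true = sym (<ᵇ-true (a<b⇒c<d (<ᵇ-true⁻ eq)))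
  ... | false = sym (<ᵇ-false (b≤a⇒d≤c (<ᵇ-false⁻ eq)))

  <ᵇ-flip : ∀ {a b} → a ≢ b → (a <ᵇ b) ≡ not (b <ᵇ a)
  <ᵇ-flip {a} {b} a≢b with <-cmp a b
  ... | tri< a<b _ _ = trans (<ᵇ-true a<b) (cong not (sym (<ᵇ-false (<⇒≤ a<b))))
  ... | tri≈ _ a≡b _ = contradiction a≡b a≢b
  ... | tri> _ _ b<a = trans (<ᵇ-false (<⇒≤ b<a)) (cong not (sym (<ᵇ-true b<a)))

  not-<ᵇ-suc : ∀ a b → not (a <ᵇ suc b) ≡ (b <ᵇ a)
  not-<ᵇ-suc a b with <-cmp b a
  ... | tri< b<a _ _ = trans (cong not (<ᵇ-false b<a)) (sym (<ᵇ-true b<a))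
  ... | tri≈ _ refl _ = trans (cong not (<ᵇ-true (n<1+n a))) (sym (<ᵇ-false (≤-refl {a})))
  ... | tri> _ _ a<b = trans (cong not (<ᵇ-true (m<n⇒m<1+n a<b))) (sym (<ᵇ-false (<⇒≤ a<b)))

  ≡ᵇ-cmp : ∀ {a b c d : ℕ} → (a ≡ b → c ≡ d) → (c ≡ d → a ≡ b) → (a ≡ᵇ b) ≡ (c ≡ᵇ d)
  ≡ᵇ-cmp {a} {b} {c} {d} a≡b⇒c≡d c≡d⇒a≡b with a ≡ᵇ b in eq₁ | c ≡ᵇ d in eq₂
  ... | true | true = refl
  ... | false | false = refl
  ... | true | false = contradiction (≡⇒≡ᵇ c d (a≡b⇒c≡d (≡ᵇ⇒≡ a b (subst T (sym eq₁) _)))) (subst T eq₂)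
  ... | false | true = contradiction (≡⇒≡ᵇ a b (c≡d⇒a≡b (≡ᵇ⇒≡ c d (subst T (sym eq₂) _)))) (subst T eq₁)

module Polynomials where

  open import Defs using (Poly; _⊕_; _⊗_; mono; one)
  open import Algebra.Bundles using (CommutativeSemiring)
  import Algebra.Construct.Pointwise as Pointwise
  import Algebra.Construct.Subst.Equality as Subst
  open import Data.Nat.Base using (ℕ; zero; suc; _+_; _*_; _∸_)
  open import Data.Nat.Properties
  open import Algebra.Properties.CommutativeSemigroup +-commutativeSemigroup
    using (interchange; x∙yz≈y∙xz)
  open import Data.Nat.ListAction using (sum)
  open import Data.List.Properties using (map-applyUpTo)
  open import Function.Base using (id; _∘_)
  open import Data.Product.Base using (_,_)
  open import Level using (0ℓ)
  open import Relation.Binary.PropositionalEquality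
  import Relation.Binary.Reasoning.Setoid as SetoidReasoning

  infix 4 _≈_
  -- Coefficientwise equality, wrapped in a record: as a bare function type it would let unification
  -- η-expand and unfold _⊕_ and _⊗_, which defeats implicit arguments and the ring solver.
  record _≈_ (f g : Poly) : Set where
    constructor coeffwise
    field coeff : f ≗ g
  open _≈_ public

  zeroₚ : Poly
  zeroₚ _ = 0

  shift : Poly → Poly
  shift f m = f (suc m)

  infixr 25 _·_
  _·_ : ℕ → Poly → Poly
  (a · f) m = a * f m

  coeff₀-⊗ : ∀ f g → (f ⊗ g) 0 ≡ f 0 * g 0
  coeff₀-⊗ f g = +-identityʳ (f 0 * g 0)

  coeff-suc-⊗ : ∀ f g m → (f ⊗ g) (suc m) ≡ f 0 * g (suc m) + (shift f ⊗ g) m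
  coeff-suc-⊗ f g m = cong (λ xs → f 0 * g (suc m) + sum xs)
    (trans (map-applyUpTo suc h (suc m)) (sym (map-applyUpTo id (h ∘ suc) (suc m))))
    where
    h : ℕ → ℕ
    h i = f i * g (suc m ∸ i)

  coeff-suc-⊗ʳ : ∀ f g m → (f ⊗ g) (suc m) ≡ f (suc m) * g 0 + (f ⊗ shift g) m
  coeff-suc-⊗ʳ f g zero = begin
    (f ⊗ g) 1                     ≡⟨ coeff-suc-⊗ f g 0 ⟩
    f 0 * g 1 + (shift f ⊗ g) 0   ≡⟨ cong (f 0 * g 1 +_) (coeff₀-⊗ (shift f) g) ⟩
    f 0 * g 1 + f 1 * g 0         ≡⟨ +-comm (f 0 * g 1) _ ⟩
    f 1 * g 0 + f 0 * g 1         ≡⟨ cong (f 1 * g 0 +_) (coeff₀-⊗ f (shift g)) ⟨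
    f 1 * g 0 + (f ⊗ shift g) 0   ∎
    where open ≡-Reasoning
  coeff-suc-⊗ʳ f g (suc m) = begin
    (f ⊗ g) (2 + m)
      ≡⟨ coeff-suc-⊗ f g (suc m) ⟩
    f 0 * g (2 + m) + (shift f ⊗ g) (suc m)
      ≡⟨ cong (f 0 * g (2 + m) +_) (coeff-suc-⊗ʳ (shift f) g m) ⟩
    f 0 * g (2 + m) + (f (2 + m) * g 0 + (shift f ⊗ shift g) m)
      ≡⟨ x∙yz≈y∙xz (f 0 * g (2 + m)) (f (2 + m) * g 0) ((shift f ⊗ shift g) m) ⟩
    f (2 + m) * g 0 + (f 0 * g (2 + m) + (shift f ⊗ shift g) m)
      ≡⟨ cong (f (2 + m) * g 0 +_) (coeff-suc-⊗ f (shift g) m) ⟨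
    f (2 + m) * g 0 + (f ⊗ shift g) (suc m)
      ∎
    where open ≡-Reasoning

  ⊗-cong : ∀ {f f′ g g′} → f ≈ f′ → g ≈ g′ → f ⊗ g ≈ f′ ⊗ g′
  ⊗-cong {f} {f′} {g} {g′} f≈f′ g≈g′ .coeff zero = begin
    (f ⊗ g) 0     ≡⟨ coeff₀-⊗ f g ⟩
    f 0 * g 0     ≡⟨ cong₂ _*_ (f≈f′ .coeff 0) (g≈g′ .coeff 0) ⟩
    f′ 0 * g′ 0   ≡⟨ coeff₀-⊗ f′ g′ ⟨
    (f′ ⊗ g′) 0   ∎
    where open ≡-Reasoning
  ⊗-cong {f} {f′} {g} {g′} f≈f′ g≈g′ .coeff (suc m) = begin
    (f ⊗ g) (suc m)                             ≡⟨ coeff-suc-⊗ f g m ⟩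
    f 0 * g (suc m) + (shift f ⊗ g) m           ≡⟨ cong₂ _+_ (cong₂ _*_ (f≈f′ .coeff 0) (g≈g′ .coeff (suc m)))
                                                             (⊗-cong (coeffwise (f≈f′ .coeff ∘ suc)) g≈g′ .coeff m) ⟩
    f′ 0 * g′ (suc m) + (shift f′ ⊗ g′) m       ≡⟨ coeff-suc-⊗ f′ g′ m ⟨
    (f′ ⊗ g′) (suc m)                           ∎
    where open ≡-Reasoning

  ⊕-congˡ : ∀ f {g g′} → g ≈ g′ → f ⊕ g ≈ f ⊕ g′
  ⊕-congˡ f g≈g′ .coeff m = cong (f m +_) (g≈g′ .coeff m)

  ⊕-congʳ : ∀ {f f′} g → f ≈ f′ → f ⊕ g ≈ f′ ⊕ g
  ⊕-congʳ g f≈f′ .coeff m = cong (_+ g m) (f≈f′ .coeff m)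

  ⊗-congˡ : ∀ f {g g′} → g ≈ g′ → f ⊗ g ≈ f ⊗ g′
  ⊗-congˡ f = ⊗-cong {f} (coeffwise λ _ → refl)

  ⊗-congʳ : ∀ {f f′} g → f ≈ f′ → f ⊗ g ≈ f′ ⊗ g
  ⊗-congʳ g f≈f′ = ⊗-cong {g = g} f≈f′ (coeffwise λ _ → refl)

  ⊗-comm : ∀ f g → f ⊗ g ≈ g ⊗ f
  ⊗-comm f g .coeff zero = begin
    (f ⊗ g) 0  ≡⟨ coeff₀-⊗ f g ⟩
    f 0 * g 0  ≡⟨ *-comm (f 0) (g 0) ⟩
    g 0 * f 0  ≡⟨ coeff₀-⊗ g f ⟨
    (g ⊗ f) 0  ∎
    where open ≡-Reasoning
  ⊗-comm f g .coeff (suc m) = begin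
    (f ⊗ g) (suc m)                     ≡⟨ coeff-suc-⊗ f g m ⟩
    f 0 * g (suc m) + (shift f ⊗ g) m   ≡⟨ cong₂ _+_ (*-comm (f 0) _) (⊗-comm (shift f) g .coeff m) ⟩
    g (suc m) * f 0 + (g ⊗ shift f) m   ≡⟨ coeff-suc-⊗ʳ g f m ⟨
    (g ⊗ f) (suc m)                     ∎
    where open ≡-Reasoning

  ⊗-distribˡ : ∀ f g h → f ⊗ (g ⊕ h) ≈ (f ⊗ g) ⊕ (f ⊗ h)
  ⊗-distribˡ f g h .coeff zero = begin
    (f ⊗ (g ⊕ h)) 0              ≡⟨ coeff₀-⊗ f (g ⊕ h) ⟩
    f 0 * (g 0 + h 0)            ≡⟨ *-distribˡ-+ (f 0) (g 0) (h 0) ⟩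
    f 0 * g 0 + f 0 * h 0        ≡⟨ cong₂ _+_ (coeff₀-⊗ f g) (coeff₀-⊗ f h) ⟨
    (f ⊗ g) 0 + (f ⊗ h) 0        ∎
    where open ≡-Reasoning
  ⊗-distribˡ f g h .coeff (suc m) = begin
    (f ⊗ (g ⊕ h)) (suc m)
      ≡⟨ coeff-suc-⊗ f (g ⊕ h) m ⟩
    f 0 * (g (suc m) + h (suc m)) + (shift f ⊗ (g ⊕ h)) m
      ≡⟨ cong₂ _+_ (*-distribˡ-+ (f 0) (g (suc m)) (h (suc m))) (⊗-distribˡ (shift f) g h .coeff m) ⟩
    (f 0 * g (suc m) + f 0 * h (suc m)) + ((shift f ⊗ g) m + (shift f ⊗ h) m)
      ≡⟨ interchange (f 0 * g (suc m)) _ _ _ ⟩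
    (f 0 * g (suc m) + (shift f ⊗ g) m) + (f 0 * h (suc m) + (shift f ⊗ h) m)
      ≡⟨ cong₂ _+_ (coeff-suc-⊗ f g m) (coeff-suc-⊗ f h m) ⟨
    (f ⊗ g) (suc m) + (f ⊗ h) (suc m)
      ∎
    where open ≡-Reasoning

  ⊗-distribʳ : ∀ f g h → (g ⊕ h) ⊗ f ≈ (g ⊗ f) ⊕ (h ⊗ f)
  ⊗-distribʳ f g h .coeff m = begin
    ((g ⊕ h) ⊗ f) m            ≡⟨ ⊗-comm (g ⊕ h) f .coeff m ⟩
    (f ⊗ (g ⊕ h)) m            ≡⟨ ⊗-distribˡ f g h .coeff m ⟩
    (f ⊗ g) m + (f ⊗ h) m      ≡⟨ cong₂ _+_ (⊗-comm f g .coeff m) (⊗-comm f h .coeff m) ⟩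
    (g ⊗ f) m + (h ⊗ f) m      ∎
    where open ≡-Reasoning

  ·-⊗ : ∀ a f g → (a · f) ⊗ g ≈ a · (f ⊗ g)
  ·-⊗ a f g .coeff zero = begin
    ((a · f) ⊗ g) 0   ≡⟨ coeff₀-⊗ (a · f) g ⟩
    a * f 0 * g 0     ≡⟨ *-assoc a (f 0) (g 0) ⟩
    a * (f 0 * g 0)   ≡⟨ cong (a *_) (coeff₀-⊗ f g) ⟨
    a * (f ⊗ g) 0     ∎
    where open ≡-Reasoning
  ·-⊗ a f g .coeff (suc m) = begin
    ((a · f) ⊗ g) (suc m)
      ≡⟨ coeff-suc-⊗ (a · f) g m ⟩
    a * f 0 * g (suc m) + ((a · shift f) ⊗ g) m
      ≡⟨ cong₂ _+_ (*-assoc a (f 0) (g (suc m))) (·-⊗ a (shift f) g .coeff m) ⟩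
    a * (f 0 * g (suc m)) + a * (shift f ⊗ g) m
      ≡⟨ *-distribˡ-+ a _ _ ⟨
    a * (f 0 * g (suc m) + (shift f ⊗ g) m)
      ≡⟨ cong (a *_) (coeff-suc-⊗ f g m) ⟨
    a * (f ⊗ g) (suc m)
      ∎
    where open ≡-Reasoning

  shift-⊗ : ∀ f g → shift (f ⊗ g) ≈ (f 0 · shift g) ⊕ (shift f ⊗ g)
  shift-⊗ f g = coeffwise (coeff-suc-⊗ f g)

  ⊗-assoc : ∀ f g h → (f ⊗ g) ⊗ h ≈ f ⊗ (g ⊗ h)
  ⊗-assoc f g h .coeff zero = begin
    ((f ⊗ g) ⊗ h) 0     ≡⟨ coeff₀-⊗ (f ⊗ g) h ⟩
    (f ⊗ g) 0 * h 0     ≡⟨ cong (_* h 0) (coeff₀-⊗ f g) ⟩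
    f 0 * g 0 * h 0     ≡⟨ *-assoc (f 0) (g 0) (h 0) ⟩
    f 0 * (g 0 * h 0)   ≡⟨ cong (f 0 *_) (coeff₀-⊗ g h) ⟨
    f 0 * (g ⊗ h) 0     ≡⟨ coeff₀-⊗ f (g ⊗ h) ⟨
    (f ⊗ (g ⊗ h)) 0     ∎
    where open ≡-Reasoning
  ⊗-assoc f g h .coeff (suc m) = begin
    ((f ⊗ g) ⊗ h) (suc m)
      ≡⟨ coeff-suc-⊗ (f ⊗ g) h m ⟩
    (f ⊗ g) 0 * h (suc m) + (shift (f ⊗ g) ⊗ h) m
      ≡⟨ cong₂ _+_ (cong (_* h (suc m)) (coeff₀-⊗ f g)) (⊗-congʳ h (shift-⊗ f g) .coeff m) ⟩
    f 0 * g 0 * h (suc m) + (((f 0 · shift g) ⊕ (shift f ⊗ g)) ⊗ h) m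
      ≡⟨ cong (f 0 * g 0 * h (suc m) +_) (⊗-distribʳ h (f 0 · shift g) (shift f ⊗ g) .coeff m) ⟩
    f 0 * g 0 * h (suc m) + (((f 0 · shift g) ⊗ h) m + ((shift f ⊗ g) ⊗ h) m)
      ≡⟨ cong (f 0 * g 0 * h (suc m) +_) (cong₂ _+_ (·-⊗ (f 0) (shift g) h .coeff m) (⊗-assoc (shift f) g h .coeff m)) ⟩
    f 0 * g 0 * h (suc m) + (f 0 * (shift g ⊗ h) m + (shift f ⊗ (g ⊗ h)) m)
      ≡⟨ +-assoc (f 0 * g 0 * h (suc m)) _ _ ⟨
    (f 0 * g 0 * h (suc m) + f 0 * (shift g ⊗ h) m) + (shift f ⊗ (g ⊗ h)) m
      ≡⟨ cong (_+ (shift f ⊗ (g ⊗ h)) m) factor ⟩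
    f 0 * (g ⊗ h) (suc m) + (shift f ⊗ (g ⊗ h)) m
      ≡⟨ coeff-suc-⊗ f (g ⊗ h) m ⟨
    (f ⊗ (g ⊗ h)) (suc m)
      ∎
    where
    open ≡-Reasoning
    factor : f 0 * g 0 * h (suc m) + f 0 * (shift g ⊗ h) m ≡ f 0 * (g ⊗ h) (suc m)
    factor = begin
      f 0 * g 0 * h (suc m) + f 0 * (shift g ⊗ h) m     ≡⟨ cong (_+ f 0 * (shift g ⊗ h) m) (*-assoc (f 0) _ _) ⟩
      f 0 * (g 0 * h (suc m)) + f 0 * (shift g ⊗ h) m   ≡⟨ *-distribˡ-+ (f 0) _ _ ⟨
      f 0 * (g 0 * h (suc m) + (shift g ⊗ h) m)         ≡⟨ cong (f 0 *_) (coeff-suc-⊗ g h m) ⟨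
      f 0 * (g ⊗ h) (suc m)                             ∎

  ⊗-identityˡ : ∀ f → one ⊗ f ≈ f
  ⊗-identityˡ f .coeff zero = trans (coeff₀-⊗ one f) (+-identityʳ (f 0))
  ⊗-identityˡ f .coeff (suc m) = begin
    (one ⊗ f) (suc m)                     ≡⟨ coeff-suc-⊗ one f m ⟩
    1 * f (suc m) + (shift one ⊗ f) m     ≡⟨ cong₂ _+_ (*-identityˡ (f (suc m))) (shift-one-⊗ f .coeff m) ⟩
    f (suc m) + 0                         ≡⟨ +-identityʳ (f (suc m)) ⟩
    f (suc m)                             ∎
    where
    open ≡-Reasoning
    shift-one-⊗ : ∀ g → shift one ⊗ g ≈ zeroₚ
    shift-one-⊗ g .coeff zero = coeff₀-⊗ (shift one) g
    shift-one-⊗ g .coeff (suc m) = trans (coeff-suc-⊗ (shift one) g m) (shift-one-⊗ g .coeff m)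

  ⊗-zeroʳ : ∀ f → f ⊗ zeroₚ ≈ zeroₚ
  ⊗-zeroʳ f .coeff zero = trans (coeff₀-⊗ f zeroₚ) (*-zeroʳ (f 0))
  ⊗-zeroʳ f .coeff (suc m) = trans (coeff-suc-⊗ f zeroₚ m) (cong₂ _+_ (*-zeroʳ (f 0)) (⊗-zeroʳ (shift f) .coeff m))

  ⊗-identityʳ : ∀ f → f ⊗ one ≈ f
  ⊗-identityʳ f .coeff m = trans (⊗-comm f one .coeff m) (⊗-identityˡ f .coeff m)

  ⊕-identityʳ : ∀ f → f ⊕ zeroₚ ≈ f
  ⊕-identityʳ f .coeff m = +-identityʳ (f m)

  commutativeSemiring : CommutativeSemiring 0ℓ 0ℓ
  commutativeSemiring = record
    { Carrier = Poly
    ; _≈_ = _≈_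
    ; _+_ = _⊕_
    ; _*_ = _⊗_
    ; 0# = zeroₚ
    ; 1# = one
    ; isCommutativeSemiring = record
      { isSemiring = record
        { isSemiringWithoutAnnihilatingZero = record
          { +-isCommutativeMonoid = Subst.isCommutativeMonoid (coeffwise , coeff)
              (Pointwise.isCommutativeMonoid ℕ +-0-isCommutativeMonoid)
          ; *-cong = ⊗-cong
          ; *-assoc = ⊗-assoc
          ; *-identity = ⊗-identityˡ , ⊗-identityʳ
          ; distrib = ⊗-distribˡ , ⊗-distribʳ
          }
        ; zero = (λ f → coeffwise λ m → trans (⊗-comm zeroₚ f .coeff m) (⊗-zeroʳ f .coeff m)) , ⊗-zeroʳ
        }
      ; *-comm = ⊗-comm
      }
    }

  mono-+ : ∀ a b → mono a ⊗ mono b ≈ mono (a + b)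
  mono-+ zero b = ⊗-identityˡ (mono b)
  mono-+ (suc a) b .coeff zero = refl
  mono-+ (suc a) b .coeff (suc m) = trans (coeff-suc-⊗ (mono (suc a)) (mono b) m) (mono-+ a b .coeff m)

  mono-*-+ : ∀ c a b → mono (c * (a + b)) ≈ mono (c * a) ⊗ mono (c * b)
  mono-*-+ c a b .coeff m = trans (cong (λ e → mono e m) (*-distribˡ-+ c a b)) (sym (mono-+ (c * a) (c * b) .coeff m))

  module ≈-Reasoning = SetoidReasoning (CommutativeSemiring.setoid commutativeSemiring)

module GeneratingFunctions where

  open import Defs using (Poly; _⊕_; _⊗_; mono)
  open Polynomials
  open Comparisons using (≡ᵇ-comm)
  open import Data.Bool.Base using (Bool; true; false; _∧_)
  open import Data.Nat.Base using (ℕ; suc; _+_; _≡ᵇ_)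
  open import Data.Nat.Properties using (+-assoc)
  open import Algebra.Properties.CommutativeSemigroup Data.Nat.Properties.+-commutativeSemigroup
    using (x∙yz≈y∙xz)
  open import Data.List.Base using (List; []; _∷_; _++_; map; length; filterᵇ)
  open import Data.List.Membership.Propositional using (_∈_)
  open import Data.List.Relation.Unary.Any using (here; there)
  open import Data.List.Relation.Binary.Permutation.Propositional using (_↭_; refl; prep; swap; trans)
  open import Function.Base using (_∘_)
  open import Relation.Binary.PropositionalEquality as ≡ using (_≡_; cong; cong₂; sym)

  private variable
    A B : Set

  gf : List A → (A → ℕ) → Poly
  gf [] f = zeroₚ
  gf (x ∷ xs) f = mono (f x) ⊕ gf xs f

  gf-++ : ∀ (xs ys : List A) f → gf (xs ++ ys) f ≈ gf xs f ⊕ gf ys f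
  gf-++ [] ys f .coeff m = ≡.refl
  gf-++ (x ∷ xs) ys f .coeff m = ≡.trans (cong (mono (f x) m +_) (gf-++ xs ys f .coeff m)) (sym (+-assoc (mono (f x) m) _ _))

  gf-map : ∀ (g : A → B) xs f → gf (map g xs) f ≈ gf xs (f ∘ g)
  gf-map g [] f .coeff m = ≡.refl
  gf-map g (x ∷ xs) f .coeff m = cong (mono (f (g x)) m +_) (gf-map g xs f .coeff m)

  gf-cong : ∀ {xs : List A} {f g} → (∀ {x} → x ∈ xs → f x ≡ g x) → gf xs f ≈ gf xs g
  gf-cong {xs = []} f≡g .coeff m = ≡.refl
  gf-cong {xs = x ∷ xs} f≡g .coeff m =
    cong₂ _+_ (cong (λ e → mono e m) (f≡g (here ≡.refl))) (gf-cong (f≡g ∘ there) .coeff m)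

  gf-↭ : ∀ {xs ys : List A} f → xs ↭ ys → gf xs f ≈ gf ys f
  gf-↭ f refl .coeff m = ≡.refl
  gf-↭ f (prep x xs↭ys) .coeff m = cong (mono (f x) m +_) (gf-↭ f xs↭ys .coeff m)
  gf-↭ f (swap x y xs↭ys) .coeff m = ≡.trans (x∙yz≈y∙xz (mono (f x) m) (mono (f y) m) _)
    (cong (λ p → mono (f y) m + (mono (f x) m + p)) (gf-↭ f xs↭ys .coeff m))
  gf-↭ f (trans xs↭ys ys↭zs) .coeff m = ≡.trans (gf-↭ f xs↭ys .coeff m) (gf-↭ f ys↭zs .coeff m)

  gf-+ : ∀ (xs : List A) e f → gf xs (λ x → e + f x) ≈ mono e ⊗ gf xs f
  gf-+ [] e f .coeff m = sym (⊗-zeroʳ (mono e) .coeff m)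
  gf-+ (x ∷ xs) e f .coeff m = ≡.trans (cong₂ _+_ (sym (mono-+ e (f x) .coeff m)) (gf-+ xs e f .coeff m))
    (sym (⊗-distribˡ (mono e) (mono (f x)) (gf xs f) .coeff m))

  gf-coefficient : ∀ (xs : List A) f m → length (filterᵇ (λ x → f x ≡ᵇ m) xs) ≡ gf xs f m
  gf-coefficient [] f m = ≡.refl
  gf-coefficient (x ∷ xs) f m rewrite ≡ᵇ-comm m (f x) with f x ≡ᵇ m
  ... | true = cong suc (gf-coefficient xs f m)
  ... | false = gf-coefficient xs f m

  filterᵇ-∧ : ∀ (p q : A → Bool) xs → filterᵇ (λ x → p x ∧ q x) xs ≡ filterᵇ q (filterᵇ p xs)
  filterᵇ-∧ p q [] = ≡.refl
  filterᵇ-∧ p q (x ∷ xs) with p x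
  ... | false = filterᵇ-∧ p q xs
  ... | true with q x
  ...   | true = cong (x ∷_) (filterᵇ-∧ p q xs)
  ...   | false = filterᵇ-∧ p q xs

module GaussianCoefficients where

  open import Defs using (Poly; _⊕_; _⊗_; mono; one; qint; qfact)
  open Polynomials
  open import Algebra.Bundles using (CommutativeSemiring)
  open import Data.Nat.Base using (ℕ; zero; suc; _+_; _*_)
  open import Data.Nat.Properties using (+-identityʳ; +-suc; +-comm)
  open import Data.Product.Base using (_×_; _,_)
  open import Data.Sum.Base using (_⊎_; inj₁; inj₂)
  open import Relation.Binary.PropositionalEquality as ≡ using (_≡_; cong)

  open CommutativeSemiring commutativeSemiring using ()
    renaming (refl to ≈-refl; sym to ≈-sym; +-cong to ⊕-cong)
  open ≈-Reasoning
  open import Algebra.Solver.Ring.NaturalCoefficients.Default commutativeSemiring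

  -- The Gaussian coefficient [k + r choose k] in q^c, by the first q-Pascal rule.
  qbinom : ℕ → ℕ → ℕ → Poly
  qbinom c k zero = one
  qbinom c zero (suc r) = one
  qbinom c (suc k) (suc r) = (mono (c * suc r) ⊗ qbinom c k (suc r)) ⊕ qbinom c (suc k) r

  qint-+ : ∀ c m n → qint c (m + n) ≈ qint c m ⊕ (mono (c * m) ⊗ qint c n)
  qint-+ c m zero = begin
    qint c (m + 0)                             ≡⟨ cong (qint c) (+-identityʳ m) ⟩
    qint c m                                   ≈⟨ solve 2 (λ A X → A := A :+ X :* con 0) ≈-refl
                                                           (qint c m) (mono (c * m)) ⟩
    qint c m ⊕ (mono (c * m) ⊗ qint c 0)       ∎
  qint-+ c m (suc n) = begin
    qint c (m + suc n)                                                 ≡⟨ cong (qint c) (+-suc m n) ⟩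
    qint c (m + n) ⊕ mono (c * (m + n))                                ≈⟨ ⊕-cong (qint-+ c m n) (mono-*-+ c m n) ⟩
    (qint c m ⊕ (mono (c * m) ⊗ qint c n)) ⊕ (mono (c * m) ⊗ mono (c * n))
      ≈⟨ solve 4 (λ A X B Y → (A :+ X :* B) :+ X :* Y := A :+ X :* (B :+ Y)) ≈-refl
               (qint c m) (mono (c * m)) (qint c n) (mono (c * n)) ⟩
    qint c m ⊕ (mono (c * m) ⊗ qint c (suc n))                         ∎

  qbinom-pascal : ∀ c k r →
    qbinom c (suc k) (suc r) ≈ qbinom c k (suc r) ⊕ (mono (c * suc k) ⊗ qbinom c (suc k) r)
  qbinom-pascal c zero zero =
    solve 1 (λ X → X :* con 1 :+ con 1 := con 1 :+ X :* con 1) ≈-refl (mono (c * 1))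
  qbinom-pascal c (suc k) zero = begin
    (mono (c * 1) ⊗ qbinom c (suc k) 1) ⊕ one
      ≈⟨ ⊕-congʳ one (⊗-congˡ (mono (c * 1)) (qbinom-pascal c k zero)) ⟩
    (mono (c * 1) ⊗ (qbinom c k 1 ⊕ (mono (c * suc k) ⊗ one))) ⊕ one
      ≈⟨ solve 3 (λ X B Y → X :* (B :+ Y :* con 1) :+ con 1
                          := (X :* B :+ con 1) :+ (X :* Y) :* con 1) ≈-refl
               (mono (c * 1)) (qbinom c k 1) (mono (c * suc k)) ⟩
    ((mono (c * 1) ⊗ qbinom c k 1) ⊕ one) ⊕ ((mono (c * 1) ⊗ mono (c * suc k)) ⊗ one)
      ≈⟨ ⊕-congˡ (qbinom c (suc k) 1) (⊗-congʳ one (≈-sym (mono-*-+ c 1 (suc k)))) ⟩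
    qbinom c (suc k) 1 ⊕ (mono (c * suc (suc k)) ⊗ one)
      ∎
  qbinom-pascal c zero (suc r) = begin
    (mono (c * suc (suc r)) ⊗ one) ⊕ qbinom c 1 (suc r)
      ≈⟨ ⊕-cong (⊗-congʳ one (mono-*-+ c 1 (suc r))) (qbinom-pascal c zero r) ⟩
    ((mono (c * 1) ⊗ mono (c * suc r)) ⊗ one) ⊕ (one ⊕ (mono (c * 1) ⊗ qbinom c 1 r))
      ≈⟨ solve 3 (λ X Y B → (X :* Y) :* con 1 :+ (con 1 :+ X :* B)
                          := con 1 :+ X :* (Y :* con 1 :+ B)) ≈-refl
               (mono (c * 1)) (mono (c * suc r)) (qbinom c 1 r) ⟩
    one ⊕ (mono (c * 1) ⊗ qbinom c 1 (suc r))
      ∎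
  qbinom-pascal c (suc k) (suc r) = begin
    (X ⊗ qbinom c (suc k) (suc (suc r))) ⊕ qbinom c (suc (suc k)) (suc r)
      ≈⟨ ⊕-cong (⊗-congˡ X (qbinom-pascal c k (suc r))) (qbinom-pascal c (suc k) r) ⟩
    (X ⊗ (qbinom c k (suc (suc r)) ⊕ (Y ⊗ M))) ⊕ (M ⊕ (Y′ ⊗ qbinom c (suc (suc k)) r))
      ≈⟨ solve 6 (λ X Y B M Y′ C → X :* (B :+ Y :* M) :+ (M :+ Y′ :* C)
                                 := (X :* B :+ M) :+ Y′ :* C :+ (X :* Y) :* M) ≈-refl
               X Y (qbinom c k (suc (suc r))) M Y′ (qbinom c (suc (suc k)) r) ⟩
    (qbinom c (suc k) (suc (suc r)) ⊕ (Y′ ⊗ qbinom c (suc (suc k)) r)) ⊕ ((X ⊗ Y) ⊗ M)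
      ≈⟨ ⊕-congˡ (qbinom c (suc k) (suc (suc r)) ⊕ (Y′ ⊗ qbinom c (suc (suc k)) r))
                 (⊗-congʳ M exchange) ⟩
    (qbinom c (suc k) (suc (suc r)) ⊕ (Y′ ⊗ qbinom c (suc (suc k)) r)) ⊕ ((Y′ ⊗ X′) ⊗ M)
      ≈⟨ solve 5 (λ B Y′ C X′ M → (B :+ Y′ :* C) :+ (Y′ :* X′) :* M
                                := B :+ Y′ :* (X′ :* M :+ C)) ≈-refl
               (qbinom c (suc k) (suc (suc r))) Y′ (qbinom c (suc (suc k)) r) X′ M ⟩
    qbinom c (suc k) (suc (suc r)) ⊕ (Y′ ⊗ qbinom c (suc (suc k)) (suc r))
      ∎
    where
    X X′ Y Y′ M : Poly
    X = mono (c * suc (suc r))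
    X′ = mono (c * suc r)
    Y = mono (c * suc k)
    Y′ = mono (c * suc (suc k))
    M = qbinom c (suc k) (suc r)
    exchange : X ⊗ Y ≈ Y′ ⊗ X′
    exchange = begin
      X ⊗ Y                              ≈⟨ ≈-sym (mono-*-+ c (suc (suc r)) (suc k)) ⟩
      mono (c * (suc (suc r) + suc k))   ≡⟨ cong (λ e → mono (c * e)) (+-comm (suc (suc r)) (suc k)) ⟩
      mono (c * (suc k + suc (suc r)))   ≡⟨ cong (λ e → mono (c * suc e)) (+-suc k (suc r)) ⟩
      mono (c * (suc (suc k) + suc r))   ≈⟨ mono-*-+ c (suc (suc k)) (suc r) ⟩
      Y′ ⊗ X′                            ∎

  qfact-qbinom : ∀ c k r → (qfact c k ⊗ qfact c r) ⊗ qbinom c k r ≈ qfact c (k + r)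
  qfact-qbinom c k zero = begin
    (qfact c k ⊗ one) ⊗ one   ≈⟨ solve 1 (λ F → (F :* con 1) :* con 1 := F) ≈-refl (qfact c k) ⟩
    qfact c k                 ≡⟨ cong (qfact c) (+-identityʳ k) ⟨
    qfact c (k + 0)           ∎
  qfact-qbinom c zero (suc r) =
    solve 1 (λ F → (con 1 :* F) :* con 1 := F) ≈-refl (qfact c (suc r))
  qfact-qbinom c (suc a) (suc b) = begin
    ((Fa ⊗ Ia) ⊗ (Fb ⊗ Ib)) ⊗ ((X ⊗ qbinom c a (suc b)) ⊕ qbinom c (suc a) b)
      ≈⟨ solve 7 (λ Fa Ia Fb Ib X Q Q′ →
                   ((Fa :* Ia) :* (Fb :* Ib)) :* (X :* Q :+ Q′)
                   := (X :* Ia) :* ((Fa :* (Fb :* Ib)) :* Q) :+ Ib :* (((Fa :* Ia) :* Fb) :* Q′))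
               ≈-refl Fa Ia Fb Ib X (qbinom c a (suc b)) (qbinom c (suc a) b) ⟩
    ((X ⊗ Ia) ⊗ ((Fa ⊗ (Fb ⊗ Ib)) ⊗ qbinom c a (suc b)))
      ⊕ (Ib ⊗ (((Fa ⊗ Ia) ⊗ Fb) ⊗ qbinom c (suc a) b))
      ≈⟨ ⊕-cong (⊗-congˡ (X ⊗ Ia) (qfact-qbinom c a (suc b))) (⊗-congˡ Ib (qfact-qbinom c (suc a) b)) ⟩
    ((X ⊗ Ia) ⊗ qfact c (a + suc b)) ⊕ (Ib ⊗ qfact c (suc a + b))
      ≡⟨ cong (λ e → ((X ⊗ Ia) ⊗ qfact c (a + suc b)) ⊕ (Ib ⊗ qfact c e)) (+-suc a b) ⟨
    ((X ⊗ Ia) ⊗ qfact c (a + suc b)) ⊕ (Ib ⊗ qfact c (a + suc b))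
      ≈⟨ solve 4 (λ X Ia F Ib → (X :* Ia) :* F :+ Ib :* F := F :* (Ib :+ X :* Ia)) ≈-refl
               X Ia (qfact c (a + suc b)) Ib ⟩
    qfact c (a + suc b) ⊗ (Ib ⊕ (X ⊗ Ia))
      ≈⟨ ⊗-congˡ (qfact c (a + suc b)) (≈-sym (qint-+ c (suc b) (suc a))) ⟩
    qfact c (a + suc b) ⊗ qint c (suc b + suc a)
      ≡⟨ cong (λ e → qfact c (a + suc b) ⊗ qint c (suc e)) (≡.trans (+-comm b (suc a)) (≡.sym (+-suc a b))) ⟩
    qfact c (suc a + suc b)
      ∎
    where
    Fa Fb Ia Ib X : Poly
    Fa = qfact c a
    Fb = qfact c b
    Ia = qint c (suc a)
    Ib = qint c (suc b)
    X = mono (c * suc b)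

  qbinom-pascal-shifted : ∀ c k r e e₁ e₂ → (e₁ ≡ e + suc r × e₂ ≡ e) ⊎ (e₁ ≡ e × e₂ ≡ e + suc k) →
    (mono (c * e₁) ⊗ qbinom c k (suc r)) ⊕ (mono (c * e₂) ⊗ qbinom c (suc k) r)
      ≈ mono (c * e) ⊗ qbinom c (suc k) (suc r)
  qbinom-pascal-shifted c k r e _ _ (inj₁ (≡.refl , ≡.refl)) = begin
    (mono (c * (e + suc r)) ⊗ qbinom c k (suc r)) ⊕ (mono (c * e) ⊗ qbinom c (suc k) r)
      ≈⟨ ⊕-congʳ (mono (c * e) ⊗ qbinom c (suc k) r)
                 (⊗-congʳ (qbinom c k (suc r)) (mono-*-+ c e (suc r))) ⟩
    ((mono (c * e) ⊗ mono (c * suc r)) ⊗ qbinom c k (suc r)) ⊕ (mono (c * e) ⊗ qbinom c (suc k) r)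
      ≈⟨ solve 4 (λ E X Q Q′ → (E :* X) :* Q :+ E :* Q′ := E :* (X :* Q :+ Q′)) ≈-refl
               (mono (c * e)) (mono (c * suc r)) (qbinom c k (suc r)) (qbinom c (suc k) r) ⟩
    mono (c * e) ⊗ qbinom c (suc k) (suc r)
      ∎
  qbinom-pascal-shifted c k r e _ _ (inj₂ (≡.refl , ≡.refl)) = begin
    (mono (c * e) ⊗ qbinom c k (suc r)) ⊕ (mono (c * (e + suc k)) ⊗ qbinom c (suc k) r)
      ≈⟨ ⊕-congˡ (mono (c * e) ⊗ qbinom c k (suc r))
                 (⊗-congʳ (qbinom c (suc k) r) (mono-*-+ c e (suc k))) ⟩
    (mono (c * e) ⊗ qbinom c k (suc r)) ⊕ ((mono (c * e) ⊗ mono (c * suc k)) ⊗ qbinom c (suc k) r)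
      ≈⟨ solve 4 (λ E Y Q Q′ → E :* Q :+ (E :* Y) :* Q′ := E :* (Q :+ Y :* Q′)) ≈-refl
               (mono (c * e)) (mono (c * suc k)) (qbinom c k (suc r)) (qbinom c (suc k) r) ⟩
    mono (c * e) ⊗ (qbinom c k (suc r) ⊕ (mono (c * suc k) ⊗ qbinom c (suc k) r))
      ≈⟨ ⊗-congˡ (mono (c * e)) (≈-sym (qbinom-pascal c k r)) ⟩
    mono (c * e) ⊗ qbinom c (suc k) (suc r)
      ∎

  qbinom-zeroˡ : ∀ c r → qbinom c 0 r ≡ one
  qbinom-zeroˡ c zero = ≡.refl
  qbinom-zeroˡ c (suc r) = ≡.refl

module MajorIndex where

  open import Defs using (Letter; _<L_; majFrom)
  open import Data.Bool.Base using (Bool; true; false; if_then_else_)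
  open import Data.Nat.Base using (ℕ; suc; _+_; _*_)
  open import Data.Nat.Properties using (+-identityʳ; +-suc; +-assoc)
  open import Data.List.Base using (List; []; _∷_; _∷ʳ_; length)
  open import Relation.Binary.PropositionalEquality as ≡ using (_≡_; refl; sym; cong; cong₂)

  ⟦_⟧ : Bool → ℕ
  ⟦ true ⟧ = 1
  ⟦ false ⟧ = 0

  descents : {A : Set} → (A → A → Bool) → List A → List Bool
  descents d [] = []
  descents d (x ∷ []) = []
  descents d (x ∷ y ∷ ys) = d x y ∷ descents d (y ∷ ys)

  positionSum : ℕ → List Bool → ℕ
  positionSum i [] = 0
  positionSum i (d ∷ ds) = ⟦ d ⟧ * i + positionSum (suc i) ds

  descents-∷ʳ : ∀ {A : Set} (d : A → A → Bool) xs x y →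
    descents d ((xs ∷ʳ x) ∷ʳ y) ≡ descents d (xs ∷ʳ x) ∷ʳ d x y
  descents-∷ʳ d [] x y = ≡.refl
  descents-∷ʳ d (x₀ ∷ []) x y = ≡.refl
  descents-∷ʳ d (x₀ ∷ x₁ ∷ xs) x y = cong (d x₀ x₁ ∷_) (descents-∷ʳ d (x₁ ∷ xs) x y)

  length-descents : ∀ {A : Set} (d : A → A → Bool) xs x → length (descents d (xs ∷ʳ x)) ≡ length xs
  length-descents d [] x = ≡.refl
  length-descents d (x₀ ∷ []) x = ≡.refl
  length-descents d (x₀ ∷ x₁ ∷ xs) x = cong suc (length-descents d (x₁ ∷ xs) x)

  positionSum-∷ʳ : ∀ i ds d → positionSum i (ds ∷ʳ d) ≡ positionSum i ds + ⟦ d ⟧ * (i + length ds)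
  positionSum-∷ʳ i [] d = ≡.trans (+-identityʳ (⟦ d ⟧ * i)) (cong (λ j → ⟦ d ⟧ * j) (≡.sym (+-identityʳ i)))
  positionSum-∷ʳ i (d₀ ∷ ds) d = ≡.trans (cong (⟦ d₀ ⟧ * i +_) (positionSum-∷ʳ (suc i) ds d))
    (≡.trans (≡.sym (+-assoc (⟦ d₀ ⟧ * i) _ _))
             (cong (λ j → ⟦ d₀ ⟧ * i + positionSum (suc i) ds + ⟦ d ⟧ * j) (≡.sym (+-suc i (length ds)))))

  letterDescent : Letter → Letter → Bool
  letterDescent x y = y <L x

  majFrom-descents : ∀ i w → majFrom i w ≡ positionSum i (descents letterDescent w)
  majFrom-descents i [] = refl
  majFrom-descents i (x ∷ []) = refl
  majFrom-descents i (x ∷ y ∷ w) = cong₂ _+_ (if≡⟦⟧ (y <L x)) (majFrom-descents (suc i) (y ∷ w))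
    where
    if≡⟦⟧ : ∀ d → (if d then i else 0) ≡ ⟦ d ⟧ * i
    if≡⟦⟧ true = sym (+-identityʳ i)
    if≡⟦⟧ false = refl

module Masks where

  open import Data.Bool.Base using (Bool; true; false)
  open import Data.Nat.Base using (ℕ; zero; suc; _+_)
  open import Data.Nat.Properties using (+-comm; +-suc; suc-injective; 0≢1+n)
  open import Data.Product.Base using (_×_; _,_; proj₁; proj₂)
  open import Data.List.Base using (List; []; _∷_; _++_; _∷ʳ_; [_]; map; replicate; length; initLast; _∷ʳ′_)
  open import Data.List.Properties using (∷ʳ-injective)
  open import Data.List.Membership.Propositional using (_∈_)
  open import Data.List.Membership.Propositional.Properties using (∈-map⁺; ∈-map⁻; ∈-++⁺ˡ; ∈-++⁺ʳ)
  open import Data.List.Relation.Unary.Any using (here)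
  open import Data.List.Relation.Unary.All as All using (All; []; _∷_)
  import Data.List.Relation.Unary.All.Properties as All
  open import Data.List.Relation.Unary.Unique.Propositional using (Unique; []; _∷_)
  import Data.List.Relation.Unary.Unique.Propositional.Properties as Unique
  open import Relation.Binary.PropositionalEquality using (_≡_; refl; sym; trans; cong)
  open import Data.Empty using (⊥; ⊥-elim)
  open import Function.Base using (_∘_)

  trues : List Bool → ℕ
  trues [] = 0
  trues (true ∷ b) = suc (trues b)
  trues (false ∷ b) = trues b

  falses : List Bool → ℕ
  falses [] = 0
  falses (true ∷ b) = falses b
  falses (false ∷ b) = suc (falses b)

  trues-∷ʳ : ∀ b x → trues (b ∷ʳ x) ≡ trues b + trues [ x ]
  trues-∷ʳ [] x = refl
  trues-∷ʳ (true ∷ b) x = cong suc (trues-∷ʳ b x)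
  trues-∷ʳ (false ∷ b) x = trues-∷ʳ b x

  falses-∷ʳ : ∀ b x → falses (b ∷ʳ x) ≡ falses b + falses [ x ]
  falses-∷ʳ [] x = refl
  falses-∷ʳ (true ∷ b) x = falses-∷ʳ b x
  falses-∷ʳ (false ∷ b) x = cong suc (falses-∷ʳ b x)

  falses+trues : ∀ b → falses b + trues b ≡ length b
  falses+trues [] = refl
  falses+trues (true ∷ b) = trans (+-suc (falses b) (trues b)) (cong suc (falses+trues b))
  falses+trues (false ∷ b) = cong suc (falses+trues b)

  falses≡0⇒replicate : ∀ b → falses b ≡ 0 → b ≡ replicate (trues b) true
  falses≡0⇒replicate [] _ = refl
  falses≡0⇒replicate (true ∷ b) eq = cong (true ∷_) (falses≡0⇒replicate b eq)

  falses-replicate : ∀ r → falses (replicate r true) ≡ 0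
  falses-replicate zero = refl
  falses-replicate (suc r) = falses-replicate r

  trues-replicate : ∀ r → trues (replicate r true) ≡ r
  trues-replicate zero = refl
  trues-replicate (suc r) = cong suc (trues-replicate r)

  -- Built by appending, so that sums over masks split according to the last entry.
  masks : ℕ → ℕ → List (List Bool)
  masks zero r = [ replicate r true ]
  masks (suc k) zero = map (_∷ʳ false) (masks k zero)
  masks (suc k) (suc r) = map (_∷ʳ false) (masks k (suc r)) ++ map (_∷ʳ true) (masks (suc k) r)

  private
    ∷ʳ-false : ∀ b {k r} → falses b ≡ k × trues b ≡ r → falses (b ∷ʳ false) ≡ suc k × trues (b ∷ʳ false) ≡ r
    ∷ʳ-false b (refl , refl) = trans (falses-∷ʳ b false) (+-comm (falses b) 1) , trans (trues-∷ʳ b false) (+-comm (trues b) 0)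

    ∷ʳ-true : ∀ b {k r} → falses b ≡ k × trues b ≡ r → falses (b ∷ʳ true) ≡ k × trues (b ∷ʳ true) ≡ suc r
    ∷ʳ-true b (refl , refl) = trans (falses-∷ʳ b true) (+-comm (falses b) 0) , trans (trues-∷ʳ b true) (+-comm (trues b) 1)

  masks-counts : ∀ k r → All (λ b → falses b ≡ k × trues b ≡ r) (masks k r)
  masks-counts zero r = (falses-replicate r , trues-replicate r) ∷ []
  masks-counts (suc k) zero = All.map⁺ (All.map (λ {b} → ∷ʳ-false b) (masks-counts k zero))
  masks-counts (suc k) (suc r) =
    All.++⁺ (All.map⁺ (All.map (λ {b} → ∷ʳ-false b) (masks-counts k (suc r))))
            (All.map⁺ (All.map (λ {b} → ∷ʳ-true b) (masks-counts (suc k) r)))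

  ∈-masks⁻ : ∀ {k r b} → b ∈ masks k r → falses b ≡ k × trues b ≡ r
  ∈-masks⁻ {k} {r} = All.lookup (masks-counts k r)

  ∈-masks⁺ : ∀ {k r} b → falses b ≡ k → trues b ≡ r → b ∈ masks k r
  ∈-masks⁺ {zero} b f≡ refl = here (falses≡0⇒replicate b f≡)
  ∈-masks⁺ {suc k} {r} b f≡ t≡ with initLast b
  ∈-masks⁺ {suc k} {r} .[] () t≡ | []
  ∈-masks⁺ {suc k} {r} .(b ∷ʳ false) f≡ t≡ | b ∷ʳ′ false =
    ∈-false r (∈-masks⁺ b (suc-injective (trans (+-comm 1 (falses b)) (trans (sym (falses-∷ʳ b false)) f≡)))
                          (trans (+-comm 0 (trues b)) (trans (sym (trues-∷ʳ b false)) t≡)))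
    where
    ∈-false : ∀ r → b ∈ masks k r → b ∷ʳ false ∈ masks (suc k) r
    ∈-false zero b∈ = ∈-map⁺ (_∷ʳ false) b∈
    ∈-false (suc r) b∈ = ∈-++⁺ˡ (∈-map⁺ (_∷ʳ false) b∈)
  ∈-masks⁺ {suc k} {zero} .(b ∷ʳ true) f≡ t≡ | b ∷ʳ′ true =
    ⊥-elim (0≢1+n (trans (sym t≡) (trans (trues-∷ʳ b true) (+-comm (trues b) 1))))
  ∈-masks⁺ {suc k} {suc r} .(b ∷ʳ true) f≡ t≡ | b ∷ʳ′ true =
    ∈-++⁺ʳ (map (_∷ʳ false) (masks k (suc r)))
      (∈-map⁺ (_∷ʳ true) (∈-masks⁺ b (trans (+-comm 0 (falses b)) (trans (sym (falses-∷ʳ b true)) f≡))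
                                      (suc-injective (trans (+-comm 1 (trues b)) (trans (sym (trues-∷ʳ b true)) t≡)))))

  masks-unique : ∀ k r → Unique (masks k r)
  masks-unique zero r = [] ∷ []
  masks-unique (suc k) zero = Unique.map⁺ (λ {b} {b′} → proj₁ ∘ ∷ʳ-injective b b′) (masks-unique k zero)
  masks-unique (suc k) (suc r) =
    Unique.++⁺ (Unique.map⁺ (λ {b} {b′} → proj₁ ∘ ∷ʳ-injective b b′) (masks-unique k (suc r)))
               (Unique.map⁺ (λ {b} {b′} → proj₁ ∘ ∷ʳ-injective b b′) (masks-unique (suc k) r))
               last-differs
    where
    last-differs : ∀ {b} → b ∈ map (_∷ʳ false) (masks k (suc r)) × b ∈ map (_∷ʳ true) (masks (suc k) r) → ⊥
    last-differs (b∈ˡ , b∈ʳ) with ∈-map⁻ (_∷ʳ false) b∈ˡ | ∈-map⁻ (_∷ʳ true) b∈ʳ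
    ... | b₁ , _ , refl | b₂ , _ , eq with () ← proj₂ (∷ʳ-injective b₁ b₂ eq)

module FixedPointInsertion where

  open import Defs using (Letter; _<L_; _⊕_; _⊗_; mono; one)
  open Polynomials
  open GeneratingFunctions
  open GaussianCoefficients
  open Masks
  open MajorIndex
  open import Algebra.Bundles using (CommutativeSemiring)
  open import Data.Bool.Base using (Bool; true; false; not)
  open import Data.Nat.Base using (ℕ; zero; suc; _+_; _*_)
  open import Data.Nat.Properties using (+-identityʳ; +-comm; suc-injective; *-zeroʳ; *-distribˡ-+)
  open import Data.Nat.Tactic.RingSolver using (solve-∀)
  open import Data.Product.Base using (_×_; _,_; proj₁; proj₂)
  open import Data.Sum.Base using (_⊎_; inj₁; inj₂)
  open import Data.List.Base using (List; []; _∷_; _++_; _∷ʳ_; map; replicate; length; initLast; _∷ʳ′_)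
  open import Data.List.Properties using (length-replicate; length-++)
  open import Data.List.Membership.Propositional using (_∈_)
  open import Data.List.Relation.Unary.All using (All)
  import Data.List.Relation.Unary.All.Properties as All
  open import Data.Unit.Base using (⊤)
  open import Data.Empty using (⊥)
  open import Data.List.Relation.Unary.Linked using (Linked; []; [-]; _∷_)
  open import Relation.Binary.PropositionalEquality as ≡ using (_≡_; cong; cong₂)

  open CommutativeSemiring commutativeSemiring using () renaming (+-cong to ⊕-cong)

  -- A colored word up to relabelling: fixed points, the letters of the derangement part (each marked
  -- by whether it is an excedance), and a final sentinel that is never part of a descent.
  data Token : Set where
    fixed : Token
    letter : Letter → Bool → Token
    end : Token

  infix 4 _▷_
  _▷_ : Token → Token → Bool
  letter x _ ▷ letter y _ = y <L x
  letter _ e ▷ fixed = e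
  letter _ _ ▷ end = false
  fixed ▷ letter _ e = not e
  fixed ▷ fixed = false
  fixed ▷ end = false
  end ▷ _ = false

  tmaj : List Token → ℕ
  tmaj T = positionSum 1 (descents _▷_ T)

  tmaj-∷ʳ : ∀ T x y → tmaj ((T ∷ʳ x) ∷ʳ y) ≡ tmaj (T ∷ʳ x) + ⟦ x ▷ y ⟧ * suc (length T)
  tmaj-∷ʳ T x y = begin
    positionSum 1 (descents _▷_ ((T ∷ʳ x) ∷ʳ y))
      ≡⟨ cong (positionSum 1) (descents-∷ʳ _▷_ T x y) ⟩
    positionSum 1 (descents _▷_ (T ∷ʳ x) ∷ʳ (x ▷ y))
      ≡⟨ positionSum-∷ʳ 1 (descents _▷_ (T ∷ʳ x)) (x ▷ y) ⟩
    tmaj (T ∷ʳ x) + ⟦ x ▷ y ⟧ * suc (length (descents _▷_ (T ∷ʳ x)))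
      ≡⟨ cong (λ n → tmaj (T ∷ʳ x) + ⟦ x ▷ y ⟧ * suc n) (length-descents _▷_ T x) ⟩
    tmaj (T ∷ʳ x) + ⟦ x ▷ y ⟧ * suc (length T)
      ∎
    where open ≡.≡-Reasoning

  ▷-end : ∀ x → (x ▷ end) ≡ false
  ▷-end fixed = ≡.refl
  ▷-end (letter _ _) = ≡.refl
  ▷-end end = ≡.refl

  tmaj-end : ∀ T → tmaj (T ∷ʳ end) ≡ tmaj T
  tmaj-end T with initLast T
  ... | [] = ≡.refl
  ... | T′ ∷ʳ′ x = ≡.trans (tmaj-∷ʳ T′ x end)
    (≡.trans (cong (λ d → tmaj (T′ ∷ʳ x) + ⟦ d ⟧ * suc (length T′)) (▷-end x)) (+-identityʳ (tmaj (T′ ∷ʳ x))))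

  replicate-∷ʳ : ∀ {A : Set} n (x : A) → replicate (suc n) x ≡ replicate n x ∷ʳ x
  replicate-∷ʳ zero x = ≡.refl
  replicate-∷ʳ (suc n) x = cong (x ∷_) (replicate-∷ʳ n x)

  tmaj-fixeds : ∀ r t → tmaj (replicate r fixed ∷ʳ t) ≡ ⟦ fixed ▷ t ⟧ * r
  tmaj-fixeds zero t = ≡.sym (*-zeroʳ ⟦ fixed ▷ t ⟧)
  tmaj-fixeds (suc r) t = begin
    tmaj (replicate (suc r) fixed ∷ʳ t)
      ≡⟨ cong (λ T → tmaj (T ∷ʳ t)) (replicate-∷ʳ r fixed) ⟩
    tmaj ((replicate r fixed ∷ʳ fixed) ∷ʳ t)
      ≡⟨ tmaj-∷ʳ (replicate r fixed) fixed t ⟩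
    tmaj (replicate r fixed ∷ʳ fixed) + ⟦ fixed ▷ t ⟧ * suc (length (replicate r fixed))
      ≡⟨ cong₂ (λ m n → m + ⟦ fixed ▷ t ⟧ * suc n) (tmaj-fixeds r fixed) (length-replicate r) ⟩
    ⟦ fixed ▷ t ⟧ * suc r
      ∎
    where open ≡.≡-Reasoning

  IsLetter : Token → Set
  IsLetter (letter _ _) = ⊤
  IsLetter _ = ⊥

  -- Putting a fixed point between x and y leaves the number of descents unchanged or adds one.
  Compatible : Token → Token → Set
  Compatible x y = (⟦ x ▷ fixed ⟧ + ⟦ fixed ▷ y ⟧ ≡ ⟦ x ▷ y ⟧)
                 ⊎ (⟦ x ▷ fixed ⟧ + ⟦ fixed ▷ y ⟧ ≡ suc ⟦ x ▷ y ⟧)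

  mergeᵗ : List Bool → List Token → List Token
  mergeᵗ [] A = []
  mergeᵗ (true ∷ b) A = fixed ∷ mergeᵗ b A
  mergeᵗ (false ∷ b) [] = []
  mergeᵗ (false ∷ b) (a ∷ A) = a ∷ mergeᵗ b A

  mergeᵗ-∷ʳ-true : ∀ b A → falses b ≡ length A → mergeᵗ (b ∷ʳ true) A ≡ mergeᵗ b A ∷ʳ fixed
  mergeᵗ-∷ʳ-true [] [] _ = ≡.refl
  mergeᵗ-∷ʳ-true (true ∷ b) A eq = cong (fixed ∷_) (mergeᵗ-∷ʳ-true b A eq)
  mergeᵗ-∷ʳ-true (false ∷ b) (a ∷ A) eq = cong (a ∷_) (mergeᵗ-∷ʳ-true b A (suc-injective eq))

  mergeᵗ-∷ʳ-false : ∀ b A a → falses b ≡ length A → mergeᵗ (b ∷ʳ false) (A ∷ʳ a) ≡ mergeᵗ b A ∷ʳ a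
  mergeᵗ-∷ʳ-false [] [] a _ = ≡.refl
  mergeᵗ-∷ʳ-false (true ∷ b) A a eq = cong (fixed ∷_) (mergeᵗ-∷ʳ-false b A a eq)
  mergeᵗ-∷ʳ-false (false ∷ b) (a′ ∷ A) a eq = cong (a′ ∷_) (mergeᵗ-∷ʳ-false b A a (suc-injective eq))

  length-mergeᵗ : ∀ b A → falses b ≡ length A → length (mergeᵗ b A) ≡ length b
  length-mergeᵗ [] [] _ = ≡.refl
  length-mergeᵗ (true ∷ b) A eq = cong suc (length-mergeᵗ b A eq)
  length-mergeᵗ (false ∷ b) (a ∷ A) eq = cong suc (length-mergeᵗ b A (suc-injective eq))

  mergeᵗ-trues : ∀ r → mergeᵗ (replicate r true) [] ≡ replicate r fixed
  mergeᵗ-trues zero = ≡.refl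
  mergeᵗ-trues (suc r) = cong (fixed ∷_) (mergeᵗ-trues r)

  compatible-fixed : ∀ x → Compatible x fixed
  compatible-fixed x = inj₁ (+-identityʳ ⟦ x ▷ fixed ⟧)

  compatible-end : ∀ x → IsLetter x → Compatible x end
  compatible-end (letter _ true) _ = inj₂ ≡.refl
  compatible-end (letter _ false) _ = inj₁ ≡.refl

  letter-fixed : ∀ x → IsLetter x → ⟦ fixed ▷ x ⟧ + ⟦ x ▷ fixed ⟧ ≡ 1
  letter-fixed (letter _ true) _ = ≡.refl
  letter-fixed (letter _ false) _ = ≡.refl

  Linked-∷ʳ⁻ : ∀ {A : Set} {R : A → A → Set} xs x y → Linked R ((xs ∷ʳ x) ∷ʳ y) → Linked R (xs ∷ʳ x) × R x y
  Linked-∷ʳ⁻ [] x y (Rxy ∷ [-]) = [-] , Rxy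
  Linked-∷ʳ⁻ (x₀ ∷ []) x y (R₀ ∷ Rxy ∷ [-]) = R₀ ∷ [-] , Rxy
  Linked-∷ʳ⁻ (x₀ ∷ x₁ ∷ xs) x y (R₀ ∷ R) with Linked-∷ʳ⁻ (x₁ ∷ xs) x y R
  ... | Rxs , Rxy = R₀ ∷ Rxs , Rxy

  Linked-∷ʳ⁺ : ∀ {A : Set} {R : A → A → Set} xs x y → Linked R (xs ∷ʳ x) → R x y → Linked R ((xs ∷ʳ x) ∷ʳ y)
  Linked-∷ʳ⁺ [] x y [-] Rxy = Rxy ∷ [-]
  Linked-∷ʳ⁺ (x₀ ∷ []) x y (R₀ ∷ [-]) Rxy = R₀ ∷ Rxy ∷ [-]
  Linked-∷ʳ⁺ (x₀ ∷ x₁ ∷ xs) x y (R₀ ∷ R) Rxy = R₀ ∷ Linked-∷ʳ⁺ (x₁ ∷ xs) x y R Rxy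

  private
    first-exponent : ∀ α β M k r → α * suc (k + suc r) + (M + β * suc r) ≡ M + α * suc k + (α + β) * suc r
    first-exponent = solve-∀

    second-exponent : ∀ γ δ M k r → δ * suc (suc k + r) + (M + γ * suc k) ≡ M + (γ + δ) * suc k + δ * suc r
    second-exponent = solve-∀

    extra-r : ∀ M α δ k r → M + α * suc k + suc δ * suc r ≡ (M + α * suc k + δ * suc r) + suc r
    extra-r = solve-∀

    extra-k : ∀ M α δ k r → M + suc α * suc k + δ * suc r ≡ (M + α * suc k + δ * suc r) + suc k
    extra-k = solve-∀

    rotate : ∀ β γ δ → γ + δ + β ≡ (β + γ) + δ
    rotate = solve-∀

  insertion-exponents : ∀ α β γ δ M k r → β + γ ≡ 1 → (γ + δ ≡ α) ⊎ (γ + δ ≡ suc α) →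
    (α * suc (k + suc r) + (M + β * suc r) ≡ (M + α * suc k + δ * suc r) + suc r ×
     δ * suc (suc k + r) + (M + γ * suc k) ≡ M + α * suc k + δ * suc r)
    ⊎
    (α * suc (k + suc r) + (M + β * suc r) ≡ M + α * suc k + δ * suc r ×
     δ * suc (suc k + r) + (M + γ * suc k) ≡ (M + α * suc k + δ * suc r) + suc k)
  insertion-exponents α β γ δ M k r β+γ≡1 (inj₁ γ+δ≡α) = inj₁
    ( ≡.trans (first-exponent α β M k r)
              (≡.trans (cong (λ x → M + α * suc k + x * suc r) α+β≡1+δ) (extra-r M α δ k r))
    , ≡.trans (second-exponent γ δ M k r) (cong (λ x → M + x * suc k + δ * suc r) γ+δ≡α) )
    where
    α+β≡1+δ : α + β ≡ 1 + δ
    α+β≡1+δ = ≡.trans (cong (_+ β) (≡.sym γ+δ≡α)) (≡.trans (rotate β γ δ) (cong (_+ δ) β+γ≡1))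
  insertion-exponents α β γ δ M k r β+γ≡1 (inj₂ γ+δ≡1+α) = inj₂
    ( ≡.trans (first-exponent α β M k r) (cong (λ x → M + α * suc k + x * suc r) α+β≡δ)
    , ≡.trans (second-exponent γ δ M k r)
              (≡.trans (cong (λ x → M + x * suc k + δ * suc r) γ+δ≡1+α) (extra-k M α δ k r)) )
    where
    α+β≡δ : α + β ≡ δ
    α+β≡δ = suc-injective (≡.trans (cong (_+ β) (≡.sym γ+δ≡1+α)) (≡.trans (rotate β γ δ) (cong (_+ δ) β+γ≡1)))

  tmaj-∷ʳ-length : ∀ T x y {n} → length T ≡ n → tmaj ((T ∷ʳ x) ∷ʳ y) ≡ tmaj (T ∷ʳ x) + ⟦ x ▷ y ⟧ * suc n
  tmaj-∷ʳ-length T x y ≡.refl = tmaj-∷ʳ T x y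

  c*tmaj-∷ʳ : ∀ c T x y {n} → length T ≡ n →
    c * tmaj ((T ∷ʳ x) ∷ʳ y) ≡ c * (⟦ x ▷ y ⟧ * suc n) + c * tmaj (T ∷ʳ x)
  c*tmaj-∷ʳ c T x y {n} length≡ = begin
    c * tmaj ((T ∷ʳ x) ∷ʳ y)                        ≡⟨ cong (c *_) (tmaj-∷ʳ-length T x y length≡) ⟩
    c * (tmaj (T ∷ʳ x) + ⟦ x ▷ y ⟧ * suc n)          ≡⟨ cong (c *_) (+-comm (tmaj (T ∷ʳ x)) _) ⟩
    c * (⟦ x ▷ y ⟧ * suc n + tmaj (T ∷ʳ x))          ≡⟨ *-distribˡ-+ c _ _ ⟩
    c * (⟦ x ▷ y ⟧ * suc n) + c * tmaj (T ∷ʳ x)      ∎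
    where open ≡.≡-Reasoning

  gf-tmaj-∷ʳ : ∀ c (M : List (List Bool)) (f : List Bool → List Token) x t n →
    (∀ {b} → b ∈ M → length (f b) ≡ n) →
    gf M (λ b → c * tmaj ((f b ∷ʳ x) ∷ʳ t))
      ≈ mono (c * (⟦ x ▷ t ⟧ * suc n)) ⊗ gf M (λ b → c * tmaj (f b ∷ʳ x))
  gf-tmaj-∷ʳ c M f x t n length≡ = begin
    gf M (λ b → c * tmaj ((f b ∷ʳ x) ∷ʳ t))                    ≈⟨ gf-cong (λ {b} b∈ → c*tmaj-∷ʳ c (f b) x t (length≡ b∈)) ⟩
    gf M (λ b → c * (⟦ x ▷ t ⟧ * suc n) + c * tmaj (f b ∷ʳ x)) ≈⟨ gf-+ M (c * (⟦ x ▷ t ⟧ * suc n)) _ ⟩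
    mono (c * (⟦ x ▷ t ⟧ * suc n)) ⊗ gf M (λ b → c * tmaj (f b ∷ʳ x)) ∎
    where open ≈-Reasoning

  length-mergeᵗ-masks : ∀ {k r b} A → length A ≡ k → b ∈ masks k r → length (mergeᵗ b A) ≡ k + r
  length-mergeᵗ-masks {b = b} A ≡.refl b∈ with falses≡ , trues≡ ← ∈-masks⁻ b∈ =
    ≡.trans (length-mergeᵗ b A falses≡) (≡.trans (≡.sym (falses+trues b)) (cong₂ _+_ falses≡ trues≡))

  gf-insertions-∷ʳ-false : ∀ c k r A a t → length A ≡ k →
    gf (map (_∷ʳ false) (masks k r)) (λ b → c * tmaj (mergeᵗ b (A ∷ʳ a) ∷ʳ t))
      ≈ mono (c * (⟦ a ▷ t ⟧ * suc (k + r))) ⊗ gf (masks k r) (λ b → c * tmaj (mergeᵗ b A ∷ʳ a))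
  gf-insertions-∷ʳ-false c k r A a t length≡ = begin
    gf (map (_∷ʳ false) (masks k r)) (λ b → c * tmaj (mergeᵗ b (A ∷ʳ a) ∷ʳ t))
      ≈⟨ gf-map (_∷ʳ false) (masks k r) _ ⟩
    gf (masks k r) (λ b → c * tmaj (mergeᵗ (b ∷ʳ false) (A ∷ʳ a) ∷ʳ t))
      ≈⟨ gf-cong (λ {b} b∈ → cong (λ T → c * tmaj (T ∷ʳ t))
                   (mergeᵗ-∷ʳ-false b A a (≡.trans (proj₁ (∈-masks⁻ b∈)) (≡.sym length≡)))) ⟩
    gf (masks k r) (λ b → c * tmaj ((mergeᵗ b A ∷ʳ a) ∷ʳ t))
      ≈⟨ gf-tmaj-∷ʳ c (masks k r) (λ b → mergeᵗ b A) a t (k + r) (length-mergeᵗ-masks A length≡) ⟩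
    mono (c * (⟦ a ▷ t ⟧ * suc (k + r))) ⊗ gf (masks k r) (λ b → c * tmaj (mergeᵗ b A ∷ʳ a))
      ∎
    where open ≈-Reasoning

  gf-insertions-∷ʳ-true : ∀ c k r A t → length A ≡ k →
    gf (map (_∷ʳ true) (masks k r)) (λ b → c * tmaj (mergeᵗ b A ∷ʳ t))
      ≈ mono (c * (⟦ fixed ▷ t ⟧ * suc (k + r))) ⊗ gf (masks k r) (λ b → c * tmaj (mergeᵗ b A ∷ʳ fixed))
  gf-insertions-∷ʳ-true c k r A t length≡ = begin
    gf (map (_∷ʳ true) (masks k r)) (λ b → c * tmaj (mergeᵗ b A ∷ʳ t))
      ≈⟨ gf-map (_∷ʳ true) (masks k r) _ ⟩
    gf (masks k r) (λ b → c * tmaj (mergeᵗ (b ∷ʳ true) A ∷ʳ t))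
      ≈⟨ gf-cong (λ {b} b∈ → cong (λ T → c * tmaj (T ∷ʳ t))
                   (mergeᵗ-∷ʳ-true b A (≡.trans (proj₁ (∈-masks⁻ b∈)) (≡.sym length≡)))) ⟩
    gf (masks k r) (λ b → c * tmaj ((mergeᵗ b A ∷ʳ fixed) ∷ʳ t))
      ≈⟨ gf-tmaj-∷ʳ c (masks k r) (λ b → mergeᵗ b A) fixed t (k + r) (length-mergeᵗ-masks A length≡) ⟩
    mono (c * (⟦ fixed ▷ t ⟧ * suc (k + r))) ⊗ gf (masks k r) (λ b → c * tmaj (mergeᵗ b A ∷ʳ fixed))
      ∎
    where open ≈-Reasoning

  mono-*-⊗-mono : ∀ c a b f → mono (c * a) ⊗ (mono (c * b) ⊗ f) ≈ mono (c * (a + b)) ⊗ f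
  mono-*-⊗-mono c a b f = begin
    mono (c * a) ⊗ (mono (c * b) ⊗ f)    ≈⟨ ⊗-assoc (mono (c * a)) (mono (c * b)) f ⟨
    (mono (c * a) ⊗ mono (c * b)) ⊗ f    ≈⟨ ⊗-congʳ f (mono-*-+ c a b) ⟨
    mono (c * (a + b)) ⊗ f               ∎
    where open ≈-Reasoning

  insertion-exponent₀ : ∀ α β δ M k → α * suc (k + 0) + (M + β * 0) ≡ M + α * suc k + δ * 0
  insertion-exponent₀ = solve-∀

  insertion-step : ∀ c k r α β γ δ M → β + γ ≡ 1 → (γ + δ ≡ α) ⊎ (γ + δ ≡ suc α) →
    (mono (c * (α * suc (k + suc r))) ⊗ (mono (c * (M + β * suc r)) ⊗ qbinom c k (suc r)))
      ⊕ (mono (c * (δ * suc (suc k + r))) ⊗ (mono (c * (M + γ * suc k)) ⊗ qbinom c (suc k) r))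
    ≈ mono (c * (M + α * suc k + δ * suc r)) ⊗ qbinom c (suc k) (suc r)
  insertion-step c k r α β γ δ M β+γ≡1 compatible = begin
    (mono (c * (α * suc (k + suc r))) ⊗ (mono (c * (M + β * suc r)) ⊗ qbinom c k (suc r)))
      ⊕ (mono (c * (δ * suc (suc k + r))) ⊗ (mono (c * (M + γ * suc k)) ⊗ qbinom c (suc k) r))
      ≈⟨ ⊕-cong (mono-*-⊗-mono c _ _ (qbinom c k (suc r))) (mono-*-⊗-mono c _ _ (qbinom c (suc k) r)) ⟩
    (mono (c * (α * suc (k + suc r) + (M + β * suc r))) ⊗ qbinom c k (suc r))
      ⊕ (mono (c * (δ * suc (suc k + r) + (M + γ * suc k))) ⊗ qbinom c (suc k) r)
      ≈⟨ qbinom-pascal-shifted c k r (M + α * suc k + δ * suc r) _ _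
           (insertion-exponents α β γ δ M k r β+γ≡1 compatible) ⟩
    mono (c * (M + α * suc k + δ * suc r)) ⊗ qbinom c (suc k) (suc r)
      ∎
    where open ≈-Reasoning

  gf-insertions : ∀ c k r A t → length A ≡ k → All IsLetter A → Linked Compatible (A ∷ʳ t) →
    gf (masks k r) (λ b → c * tmaj (mergeᵗ b A ∷ʳ t))
      ≈ mono (c * (tmaj (A ∷ʳ t) + ⟦ fixed ▷ t ⟧ * r)) ⊗ qbinom c k r
  gf-insertions c zero r [] t _ _ _ = begin
    mono (c * tmaj (mergeᵗ (replicate r true) [] ∷ʳ t)) ⊕ zeroₚ
      ≈⟨ ⊕-identityʳ _ ⟩
    mono (c * tmaj (mergeᵗ (replicate r true) [] ∷ʳ t))
      ≡⟨ cong (λ T → mono (c * tmaj (T ∷ʳ t))) (mergeᵗ-trues r) ⟩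
    mono (c * tmaj (replicate r fixed ∷ʳ t))
      ≡⟨ cong (λ e → mono (c * e)) (tmaj-fixeds r t) ⟩
    mono (c * (⟦ fixed ▷ t ⟧ * r))
      ≈⟨ ⊗-identityʳ _ ⟨
    mono (c * (⟦ fixed ▷ t ⟧ * r)) ⊗ one
      ≡⟨ cong (mono (c * (⟦ fixed ▷ t ⟧ * r)) ⊗_) (qbinom-zeroˡ c r) ⟨
    mono (c * (⟦ fixed ▷ t ⟧ * r)) ⊗ qbinom c 0 r
      ∎
    where open ≈-Reasoning
  gf-insertions c (suc k) r A t length≡ letters chain with initLast A
  gf-insertions c (suc k) r .[] t () letters chain | []
  gf-insertions c (suc k) zero .(A ∷ʳ a) t length≡ letters chain | A ∷ʳ′ a = begin
    gf (map (_∷ʳ false) (masks k 0)) (λ b → c * tmaj (mergeᵗ b (A ∷ʳ a) ∷ʳ t))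
      ≈⟨ gf-insertions-∷ʳ-false c k 0 A a t lengthA ⟩
    mono (c * (⟦ a ▷ t ⟧ * suc (k + 0))) ⊗ gf (masks k 0) (λ b → c * tmaj (mergeᵗ b A ∷ʳ a))
      ≈⟨ ⊗-congˡ (mono (c * (⟦ a ▷ t ⟧ * suc (k + 0)))) (gf-insertions c k 0 A a lengthA lettersA chainA) ⟩
    mono (c * (⟦ a ▷ t ⟧ * suc (k + 0))) ⊗ (mono (c * (tmaj (A ∷ʳ a) + ⟦ fixed ▷ a ⟧ * 0)) ⊗ one)
      ≈⟨ mono-*-⊗-mono c _ _ one ⟩
    mono (c * (⟦ a ▷ t ⟧ * suc (k + 0) + (tmaj (A ∷ʳ a) + ⟦ fixed ▷ a ⟧ * 0))) ⊗ one
      ≡⟨ cong (λ e → mono (c * e) ⊗ one)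
              (insertion-exponent₀ ⟦ a ▷ t ⟧ ⟦ fixed ▷ a ⟧ ⟦ fixed ▷ t ⟧ (tmaj (A ∷ʳ a)) k) ⟩
    mono (c * (tmaj (A ∷ʳ a) + ⟦ a ▷ t ⟧ * suc k + ⟦ fixed ▷ t ⟧ * 0)) ⊗ one
      ≡⟨ cong (λ e → mono (c * (e + ⟦ fixed ▷ t ⟧ * 0)) ⊗ one) (tmaj-∷ʳ-length A a t lengthA) ⟨
    mono (c * (tmaj ((A ∷ʳ a) ∷ʳ t) + ⟦ fixed ▷ t ⟧ * 0)) ⊗ one
      ∎
    where
    open ≈-Reasoning
    lengthA : length A ≡ k
    lengthA = suc-injective (≡.trans (+-comm 1 (length A)) (≡.trans (≡.sym (length-++ A)) length≡))
    lettersA : All IsLetter A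
    lettersA = proj₁ (All.∷ʳ⁻ letters)
    chainA : Linked Compatible (A ∷ʳ a)
    chainA = proj₁ (Linked-∷ʳ⁻ A a t chain)
  gf-insertions c (suc k) (suc r) .(A ∷ʳ a) t length≡ letters chain | A ∷ʳ′ a = begin
    gf (map (_∷ʳ false) (masks k (suc r)) ++ map (_∷ʳ true) (masks (suc k) r))
       (λ b → c * tmaj (mergeᵗ b (A ∷ʳ a) ∷ʳ t))
      ≈⟨ gf-++ (map (_∷ʳ false) (masks k (suc r))) (map (_∷ʳ true) (masks (suc k) r)) _ ⟩
    gf (map (_∷ʳ false) (masks k (suc r))) (λ b → c * tmaj (mergeᵗ b (A ∷ʳ a) ∷ʳ t))
      ⊕ gf (map (_∷ʳ true) (masks (suc k) r)) (λ b → c * tmaj (mergeᵗ b (A ∷ʳ a) ∷ʳ t))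
      ≈⟨ ⊕-cong (gf-insertions-∷ʳ-false c k (suc r) A a t lengthA)
                (gf-insertions-∷ʳ-true c (suc k) r (A ∷ʳ a) t length≡) ⟩
    (mono (c * (α * suc (k + suc r))) ⊗ gf (masks k (suc r)) (λ b → c * tmaj (mergeᵗ b A ∷ʳ a)))
      ⊕ (mono (c * (δ * suc (suc k + r))) ⊗ gf (masks (suc k) r) (λ b → c * tmaj (mergeᵗ b (A ∷ʳ a) ∷ʳ fixed)))
      ≈⟨ ⊕-cong (⊗-congˡ (mono (c * (α * suc (k + suc r)))) (gf-insertions c k (suc r) A a lengthA lettersA chainA))
                (⊗-congˡ (mono (c * (δ * suc (suc k + r))))
                         (gf-insertions c (suc k) r (A ∷ʳ a) fixed length≡ letters chainFixed)) ⟩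
    (mono (c * (α * suc (k + suc r))) ⊗ (mono (c * (M + β * suc r)) ⊗ qbinom c k (suc r)))
      ⊕ (mono (c * (δ * suc (suc k + r))) ⊗ (mono (c * (tmaj ((A ∷ʳ a) ∷ʳ fixed) + 0 * r)) ⊗ qbinom c (suc k) r))
      ≡⟨ cong (λ e → (mono (c * (α * suc (k + suc r))) ⊗ (mono (c * (M + β * suc r)) ⊗ qbinom c k (suc r)))
                      ⊕ (mono (c * (δ * suc (suc k + r))) ⊗ (mono (c * e) ⊗ qbinom c (suc k) r)))
              (≡.trans (+-identityʳ _) (tmaj-∷ʳ-length A a fixed lengthA)) ⟩
    (mono (c * (α * suc (k + suc r))) ⊗ (mono (c * (M + β * suc r)) ⊗ qbinom c k (suc r)))
      ⊕ (mono (c * (δ * suc (suc k + r))) ⊗ (mono (c * (M + γ * suc k)) ⊗ qbinom c (suc k) r))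
      ≈⟨ insertion-step c k r α β γ δ M (letter-fixed a (proj₂ (All.∷ʳ⁻ letters)))
                                        (proj₂ (Linked-∷ʳ⁻ A a t chain)) ⟩
    mono (c * (M + α * suc k + δ * suc r)) ⊗ qbinom c (suc k) (suc r)
      ≡⟨ cong (λ e → mono (c * (e + δ * suc r)) ⊗ qbinom c (suc k) (suc r)) (tmaj-∷ʳ-length A a t lengthA) ⟨
    mono (c * (tmaj ((A ∷ʳ a) ∷ʳ t) + δ * suc r)) ⊗ qbinom c (suc k) (suc r)
      ∎
    where
    open ≈-Reasoning
    α β γ δ M : ℕ
    α = ⟦ a ▷ t ⟧
    β = ⟦ fixed ▷ a ⟧
    γ = ⟦ a ▷ fixed ⟧
    δ = ⟦ fixed ▷ t ⟧
    M = tmaj (A ∷ʳ a)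
    lengthA : length A ≡ k
    lengthA = suc-injective (≡.trans (+-comm 1 (length A)) (≡.trans (≡.sym (length-++ A)) length≡))
    lettersA : All IsLetter A
    lettersA = proj₁ (All.∷ʳ⁻ letters)
    chainA : Linked Compatible (A ∷ʳ a)
    chainA = proj₁ (Linked-∷ʳ⁻ A a t chain)
    chainFixed : Linked Compatible ((A ∷ʳ a) ∷ʳ fixed)
    chainFixed = Linked-∷ʳ⁺ A a fixed chainA (compatible-fixed a)

module ListPermutations where

  open import Data.Bool.Base using (Bool)
  open import Data.Nat.Base using (ℕ; zero; suc; _≤_; s≤s; z≤n)
  open import Data.Nat.Properties using (≤-trans; ≤-reflexive; suc-injective; +-suc; <⇒≢; ≤-pred)
  open import Data.Product.Base using (_×_; _,_)
  open import Data.Sum.Base using (inj₁; inj₂)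
  open import Data.Empty using (⊥-elim)
  open import Data.List.Base using (List; []; _∷_; _++_; length; filterᵇ; applyUpTo)
  open import Data.List.Properties using (length-++; length-applyUpTo)
  open import Data.List.Membership.Propositional using (_∈_)
  open import Data.List.Membership.Propositional.Properties
    using (∈-∃++; ∈-++⁺ˡ; ∈-++⁺ʳ; ∈-++⁻; ∈-applyUpTo⁻)
  open import Data.List.Membership.Propositional.Properties.WithK using (unique∧set⇒bag)
  open import Data.List.Relation.Unary.Any using (here; there)
  open import Data.List.Relation.Unary.All as All using (All)
  open import Data.List.Relation.Unary.Unique.Propositional using (Unique; _∷_)
  import Data.List.Relation.Unary.Unique.Propositional.Properties as Unique
  open import Data.List.Relation.Binary.BagAndSetEquality using (∼bag⇒↭)
  open import Data.List.Relation.Binary.Permutation.Propositional using (_↭_; ↭-refl; ↭-prep; ↭-trans; ↭-sym; ↭⇒↭ₛ)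
  open import Data.List.Relation.Binary.Permutation.Propositional.Properties
    using (shift; ↭-length; drop-∷; filter-↭)
  import Data.List.Relation.Binary.Permutation.Setoid.Properties as Permutationₛ
  open import Function.Base using (_∘_)
  open import Function.Bundles using (mk⇔)
  open import Relation.Binary.PropositionalEquality using (_≡_; refl; sym; trans; cong; cong₂; setoid)
  open import Relation.Nullary.Decidable using (T?)

  private variable
    A : Set

  unique∧same⇒↭ : {xs ys : List A} → Unique xs → Unique ys →
    (∀ {x} → x ∈ xs → x ∈ ys) → (∀ {x} → x ∈ ys → x ∈ xs) → xs ↭ ys
  unique∧same⇒↭ xs! ys! xs⊆ys ys⊆xs = ∼bag⇒↭ (unique∧set⇒bag xs! ys! (mk⇔ xs⊆ys ys⊆xs))

  Unique-resp-↭ : {xs ys : List A} → Unique xs → xs ↭ ys → Unique ys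
  Unique-resp-↭ {A} xs! xs↭ys = Permutationₛ.Unique-resp-↭ (setoid A) (↭⇒↭ₛ xs↭ys) xs!

  unique∧⊆∧length⇒↭ : {xs ys : List A} → Unique xs → (∀ {x} → x ∈ xs → x ∈ ys) →
    length ys ≤ length xs → xs ↭ ys
  unique∧⊆∧length⇒↭ {xs = []} {[]} _ _ _ = ↭-refl
  unique∧⊆∧length⇒↭ {xs = x ∷ xs} {ys} (x∉xs ∷ xs!) xs⊆ys ys≤
    with as , bs , refl ← ∈-∃++ (xs⊆ys (here refl)) =
    ↭-trans (↭-prep x (unique∧⊆∧length⇒↭ xs! xs⊆as++bs (≤-pred (≤-trans (≤-reflexive length-as++x∷bs) ys≤))))
            (↭-sym (shift x as bs))
    where
    length-as++x∷bs : suc (length (as ++ bs)) ≡ length (as ++ x ∷ bs)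
    length-as++x∷bs = trans (cong suc (length-++ as)) (trans (sym (+-suc (length as) (length bs))) (sym (length-++ as)))
    xs⊆as++bs : ∀ {y} → y ∈ xs → y ∈ as ++ bs
    xs⊆as++bs y∈ with ∈-++⁻ as (xs⊆ys (there y∈))
    ... | inj₁ y∈as = ∈-++⁺ˡ y∈as
    ... | inj₂ (here refl) = ⊥-elim (All.lookup x∉xs y∈ refl)
    ... | inj₂ (there y∈bs) = ∈-++⁺ʳ as y∈bs

  ++-cancelˡ-↭ : (as : List A) {xs ys : List A} → as ++ xs ↭ as ++ ys → xs ↭ ys
  ++-cancelˡ-↭ [] xs↭ys = xs↭ys
  ++-cancelˡ-↭ (a ∷ as) a∷xs↭a∷ys = ++-cancelˡ-↭ as (drop-∷ a∷xs↭a∷ys)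

  length-filterᵇ-↭ : (p : A → Bool) {xs ys : List A} → xs ↭ ys → length (filterᵇ p xs) ≡ length (filterᵇ p ys)
  length-filterᵇ-↭ p xs↭ys = ↭-length (filter-↭ (T? ∘ p) xs↭ys)

  oneTo : ℕ → List ℕ
  oneTo = applyUpTo suc

  ∈-oneTo⁻ : ∀ {n v} → v ∈ oneTo n → 1 ≤ v × v ≤ n
  ∈-oneTo⁻ v∈ with _ , i<n , refl ← ∈-applyUpTo⁻ suc v∈ = s≤s z≤n , i<n

  oneTo-unique : ∀ n → Unique (oneTo n)
  oneTo-unique n = Unique.applyUpTo⁺₁ suc n (λ i<j _ → <⇒≢ i<j ∘ suc-injective)

  ↭-oneTo : ∀ n {xs} → Unique xs → All (_∈ oneTo n) xs → length xs ≡ n → xs ↭ oneTo n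
  ↭-oneTo n xs! xs⊆ length≡ =
    unique∧⊆∧length⇒↭ xs! (All.lookup xs⊆) (≤-reflexive (trans (length-applyUpTo suc n) (sym length≡)))

  applyUpTo-cong : ∀ {f g : ℕ → A} n → (∀ i → f i ≡ g i) → applyUpTo f n ≡ applyUpTo g n
  applyUpTo-cong zero f≡g = refl
  applyUpTo-cong (suc n) f≡g = cong₂ _∷_ (f≡g 0) (applyUpTo-cong n (f≡g ∘ suc))

module Standardization where

  open import Defs using (Letter; Word; val; color; col; rank; standardize)
  open ListPermutations
  open Comparisons
  open import Data.Bool.Base using (Bool; true; false)
  open import Data.Nat.Base using (ℕ; zero; suc; pred; _+_; _<_; _≤_; _<ᵇ_; s≤s; z≤n)
  open import Data.Nat.Properties
  open import Data.Product.Base using (_,_)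
  open import Data.Sum.Base using (inj₁; inj₂)
  open import Data.List.Base using (List; []; _∷_; _++_; map; length; filterᵇ; applyUpTo)
  open import Data.Nat.ListAction using (sum)
  open import Data.List.Properties using (map-∘; map-applyUpTo; map-id-local)
  open import Data.List.Membership.Propositional using (_∈_)
  open import Data.List.Membership.Propositional.Properties using (∈-map⁺)
  open import Data.List.Relation.Unary.Any using (here; there)
  open import Data.List.Relation.Unary.All as All using (All; []; _∷_)
  open import Data.List.Relation.Unary.AllPairs using (AllPairs; []; _∷_)
  open import Data.List.Relation.Binary.Permutation.Propositional using (_↭_)
  open import Data.List.Relation.Binary.Permutation.Propositional.Properties using (∈-resp-↭)
  open import Function.Base using (_∘_)
  open import Relation.Binary.Definitions using (tri<; tri≈; tri>)
  open import Relation.Binary.PropositionalEquality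
  open import Relation.Nullary.Negation using (contradiction)

  vals : Word → List ℕ
  vals = map val

  nth : List ℕ → ℕ → ℕ
  nth [] _ = 0
  nth (x ∷ xs) zero = x
  nth (x ∷ xs) (suc j) = nth xs j

  Sorted : List ℕ → Set
  Sorted = AllPairs _<_

  nth-∈ : ∀ P {j} → j < length P → nth P j ∈ P
  nth-∈ (x ∷ P) {zero} _ = here refl
  nth-∈ (x ∷ P) {suc j} (s≤s j<) = there (nth-∈ P j<)

  nth-++ˡ : ∀ xs ys {w} → w < length xs → nth (xs ++ ys) w ≡ nth xs w
  nth-++ˡ (x ∷ xs) ys {zero} _ = refl
  nth-++ˡ (x ∷ xs) ys {suc w} (s≤s w<) = nth-++ˡ xs ys w<

  nth-++ʳ : ∀ xs ys u → nth (xs ++ ys) (length xs + u) ≡ nth ys u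
  nth-++ʳ [] ys u = refl
  nth-++ʳ (x ∷ xs) ys u = nth-++ʳ xs ys u

  nth-mono : ∀ {P} → Sorted P → ∀ {i j} → i < j → j < length P → nth P i < nth P j
  nth-mono {x ∷ P} (x< ∷ _) {zero} {suc j} _ (s≤s j<) = All.lookup x< (nth-∈ P j<)
  nth-mono {x ∷ P} (_ ∷ P-sorted) {suc i} {suc j} (s≤s i<j) (s≤s j<) = nth-mono P-sorted i<j j<

  nth-monoᵇ : ∀ {P} → Sorted P → ∀ {i j} → i < length P → j < length P → (i <ᵇ j) ≡ (nth P i <ᵇ nth P j)
  nth-monoᵇ {P} P-sorted {i} {j} i< j< = <ᵇ-cmp (λ i<j → nth-mono P-sorted i<j j<) (λ j≤i → mono≤ j≤i)
    where
    mono≤ : j ≤ i → nth P j ≤ nth P i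
    mono≤ j≤i with m≤n⇒m<n∨m≡n j≤i
    ... | inj₁ j<i = <⇒≤ (nth-mono P-sorted j<i i<)
    ... | inj₂ refl = ≤-refl

  nth-injective : ∀ {P} → Sorted P → ∀ {i j} → i < length P → j < length P → nth P i ≡ nth P j → i ≡ j
  nth-injective P-sorted {i} {j} i< j< eq with <-cmp i j
  ... | tri< i<j _ _ = contradiction eq (<⇒≢ (nth-mono P-sorted i<j j<))
  ... | tri≈ _ i≡j _ = i≡j
  ... | tri> _ _ j<i = contradiction (sym eq) (<⇒≢ (nth-mono P-sorted j<i i<))

  length-filterᵇ-none : ∀ {A : Set} (p : A → Bool) {xs} → All (λ x → p x ≡ false) xs → length (filterᵇ p xs) ≡ 0
  length-filterᵇ-none p [] = refl
  length-filterᵇ-none p (px≡false ∷ rest) rewrite px≡false = length-filterᵇ-none p rest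

  length-filterᵇ-map : ∀ {A B : Set} (p : B → Bool) (g : A → B) xs →
    length (filterᵇ p (map g xs)) ≡ length (filterᵇ (p ∘ g) xs)
  length-filterᵇ-map p g [] = refl
  length-filterᵇ-map p g (x ∷ xs) with p (g x)
  ... | true = cong suc (length-filterᵇ-map p g xs)
  ... | false = length-filterᵇ-map p g xs

  count-below-nth : ∀ {P} → Sorted P → ∀ {j} → j < length P → length (filterᵇ (_<ᵇ nth P j) P) ≡ j
  count-below-nth {x ∷ P} (x< ∷ _) {zero} _ rewrite <ᵇ-false (≤-refl {x}) =
    length-filterᵇ-none (_<ᵇ x) (All.map (λ x<y → <ᵇ-false (<⇒≤ x<y)) x<)
  count-below-nth {x ∷ P} (x< ∷ P-sorted) {suc j} (s≤s j<) rewrite <ᵇ-true (All.lookup x< (nth-∈ P j<)) =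
    cong suc (count-below-nth P-sorted j<)

  nth-count-below : ∀ {P} → Sorted P → ∀ {v} → v ∈ P → nth P (length (filterᵇ (_<ᵇ v) P)) ≡ v
  nth-count-below {x ∷ P} (x< ∷ _) (here refl)
    rewrite <ᵇ-false (≤-refl {x}) | length-filterᵇ-none (_<ᵇ x) (All.map (λ x<y → <ᵇ-false (<⇒≤ x<y)) x<) = refl
  nth-count-below {x ∷ P} (x< ∷ P-sorted) {v} (there v∈P) rewrite <ᵇ-true (All.lookup x< v∈P) =
    nth-count-below P-sorted v∈P

  map-nth-oneTo : ∀ P → map (nth P ∘ pred) (oneTo (length P)) ≡ P
  map-nth-oneTo P = trans (map-applyUpTo suc (nth P ∘ pred) (length P)) (applyUpTo-nth P)
    where
    applyUpTo-nth : ∀ P → applyUpTo (nth P) (length P) ≡ P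
    applyUpTo-nth [] = refl
    applyUpTo-nth (x ∷ P) = cong (x ∷_) (applyUpTo-nth P)

  relabel : List ℕ → Letter → Letter
  relabel P (v , t) = nth P (pred v) , t

  vals-relabel : ∀ P σ → vals (map (relabel P) σ) ≡ map (nth P ∘ pred) (vals σ)
  vals-relabel P σ = trans (sym (map-∘ σ)) (map-∘ σ)

  standardize-relabel : ∀ {P} σ → Sorted P → vals σ ↭ oneTo (length P) → standardize (map (relabel P) σ) ≡ σ
  standardize-relabel {P} σ P-sorted vals↭ = trans (sym (map-∘ σ)) (map-id-local (All.tabulate rank-relabel))
    where
    rank-relabel : ∀ {x} → x ∈ σ → (rank (val (relabel P x)) (vals (map (relabel P) σ)) , color x) ≡ x
    rank-relabel {v , t} x∈σ with ∈-oneTo⁻ (∈-resp-↭ vals↭ (∈-map⁺ val x∈σ))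
    ... | s≤s z≤n , v≤ = cong (_, t) (begin
      suc (length (filterᵇ (_<ᵇ nth P (pred v)) (vals (map (relabel P) σ))))
        ≡⟨ cong (λ vs → suc (length (filterᵇ (_<ᵇ nth P (pred v)) vs))) (vals-relabel P σ) ⟩
      suc (length (filterᵇ (_<ᵇ nth P (pred v)) (map (nth P ∘ pred) (vals σ))))
        ≡⟨ cong suc (length-filterᵇ-map _ (nth P ∘ pred) (vals σ)) ⟩
      suc (length (filterᵇ ((_<ᵇ nth P (pred v)) ∘ nth P ∘ pred) (vals σ)))
        ≡⟨ cong suc (length-filterᵇ-↭ _ vals↭) ⟩
      suc (length (filterᵇ ((_<ᵇ nth P (pred v)) ∘ nth P ∘ pred) (oneTo (length P))))
        ≡⟨ cong suc (length-filterᵇ-map _ (nth P ∘ pred) (oneTo (length P))) ⟨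
      suc (length (filterᵇ (_<ᵇ nth P (pred v)) (map (nth P ∘ pred) (oneTo (length P)))))
        ≡⟨ cong (λ vs → suc (length (filterᵇ (_<ᵇ nth P (pred v)) vs))) (map-nth-oneTo P) ⟩
      suc (length (filterᵇ (_<ᵇ nth P (pred v)) P))
        ≡⟨ cong suc (count-below-nth P-sorted v≤) ⟩
      v ∎)
      where open ≡-Reasoning

  relabel-standardize : ∀ {P} u → Sorted P → vals u ↭ P → map (relabel P) (standardize u) ≡ u
  relabel-standardize {P} u P-sorted vals↭ = trans (sym (map-∘ u)) (map-id-local (All.tabulate relabel-rank))
    where
    relabel-rank : ∀ {x} → x ∈ u → relabel P (rank (val x) (vals u) , color x) ≡ x
    relabel-rank {v , t} x∈u = cong (_, t)
      (trans (cong (nth P) (length-filterᵇ-↭ (_<ᵇ v) vals↭))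
             (nth-count-below P-sorted (∈-resp-↭ vals↭ (∈-map⁺ val x∈u))))

  col-relabel : ∀ P σ → col (map (relabel P) σ) ≡ col σ
  col-relabel P σ = cong sum (sym (map-∘ σ))

module FixedPointDecomposition where

  open import Defs using (Word; val; color; col; isFixed; indexedFrom; nonFixed)
  open ListPermutations
  open Masks using (falses)
  open Standardization using (vals; Sorted)
  open import Data.Bool.Base using (Bool; true; false; not; if_then_else_; T)
  open import Data.Bool.Properties using (∧-identityʳ)
  open import Data.Nat.Base using (ℕ; zero; suc; _+_; _<_; _≤_; _≡ᵇ_)
  open import Data.Nat.Properties using (+-identityʳ; +-suc; suc-injective; ≡ᵇ⇒≡; ≡⇒≡ᵇ; <⇒≤; ≤-refl)
  open import Data.Product.Base using (_×_; _,_; proj₁; proj₂)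
  open import Data.List.Base using (List; []; _∷_; _++_; map; length; filterᵇ; applyUpTo)
  open import Data.List.Relation.Binary.Pointwise using (Pointwise; []; _∷_)
  open import Data.List.Relation.Unary.All as All using (All; []; _∷_)
  open import Data.List.Relation.Unary.AllPairs using ([]; _∷_)
  open import Data.List.Membership.Propositional using (_∈_)
  open import Data.List.Relation.Unary.Any using (here; there)
  open import Data.List.Relation.Binary.Permutation.Propositional using (_↭_; ↭-refl; ↭-prep; ↭-trans; ↭-sym; ↭-reflexive)
  open import Data.List.Relation.Binary.Permutation.Propositional.Properties using (shift)
  open import Relation.Binary.PropositionalEquality

  truePositions : ℕ → List Bool → List ℕ
  truePositions i [] = []
  truePositions i (true ∷ b) = i ∷ truePositions (suc i) b
  truePositions i (false ∷ b) = truePositions (suc i) b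

  falsePositions : ℕ → List Bool → List ℕ
  falsePositions i [] = []
  falsePositions i (true ∷ b) = falsePositions (suc i) b
  falsePositions i (false ∷ b) = i ∷ falsePositions (suc i) b

  length-falsePositions : ∀ i b → length (falsePositions i b) ≡ falses b
  length-falsePositions i [] = refl
  length-falsePositions i (true ∷ b) = length-falsePositions (suc i) b
  length-falsePositions i (false ∷ b) = cong suc (length-falsePositions (suc i) b)

  applyUpTo-+-suc : ∀ i n → i ∷ applyUpTo (suc i +_) n ≡ applyUpTo (i +_) (suc n)
  applyUpTo-+-suc i n = cong₂ _∷_ (sym (+-identityʳ i)) (applyUpTo-cong n (λ x → sym (+-suc i x)))

  positions-↭ : ∀ i b → truePositions i b ++ falsePositions i b ↭ applyUpTo (i +_) (length b)
  positions-↭ i [] = ↭-refl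
  positions-↭ i (true ∷ b) = ↭-trans (↭-prep i (positions-↭ (suc i) b)) (↭-reflexive (applyUpTo-+-suc i (length b)))
  positions-↭ i (false ∷ b) =
    ↭-trans (shift i (truePositions (suc i) b) (falsePositions (suc i) b))
            (↭-trans (↭-prep i (positions-↭ (suc i) b)) (↭-reflexive (applyUpTo-+-suc i (length b))))

  fixedMask : ℕ → Word → List Bool
  fixedMask i [] = []
  fixedMask i (x ∷ w) = isFixed i x ∷ fixedMask (suc i) w

  nonFixedFrom : ℕ → Word → Word
  nonFixedFrom i [] = []
  nonFixedFrom i (x ∷ w) = if isFixed i x then nonFixedFrom (suc i) w else x ∷ nonFixedFrom (suc i) w

  nonFixedFrom-indexed : ∀ i w →
    map proj₂ (filterᵇ (λ p → not (isFixed (proj₁ p) (proj₂ p))) (indexedFrom i w)) ≡ nonFixedFrom i w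
  nonFixedFrom-indexed i [] = refl
  nonFixedFrom-indexed i (x ∷ w) with isFixed i x
  ... | true = nonFixedFrom-indexed (suc i) w
  ... | false = cong (x ∷_) (nonFixedFrom-indexed (suc i) w)

  merge : ℕ → List Bool → Word → Word
  merge i [] L = []
  merge i (true ∷ b) L = (i , 0) ∷ merge (suc i) b L
  merge i (false ∷ b) [] = []
  merge i (false ∷ b) (x ∷ L) = x ∷ merge (suc i) b L

  isFixed⇒≡ : ∀ i x → isFixed i x ≡ true → x ≡ (i , 0)
  isFixed⇒≡ i (v , t) eq with v ≡ᵇ i in v≡i | t ≡ᵇ 0 in t≡0
  ... | true | true = cong₂ _,_ (≡ᵇ⇒≡ v i (subst T (sym v≡i) _)) (≡ᵇ⇒≡ t 0 (subst T (sym t≡0) _))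

  isFixed⇒≢ : ∀ {i v} → isFixed i (v , 0) ≡ false → v ≢ i
  isFixed⇒≢ {i} {v} nonFixed refl = subst T (trans (sym (∧-identityʳ (v ≡ᵇ v))) nonFixed) (≡⇒≡ᵇ v v refl)

  isFixed-refl : ∀ i → isFixed i (i , 0) ≡ true
  isFixed-refl zero = refl
  isFixed-refl (suc i) = isFixed-refl i

  merge-split : ∀ i w → merge i (fixedMask i w) (nonFixedFrom i w) ≡ w
  merge-split i [] = refl
  merge-split i (x ∷ w) with isFixed i x in fixed
  ... | true = cong₂ _∷_ (sym (isFixed⇒≡ i x fixed)) (merge-split (suc i) w)
  ... | false = cong (x ∷_) (merge-split (suc i) w)

  NonFixedAt : List ℕ → Word → Set
  NonFixedAt = Pointwise (λ p x → isFixed p x ≡ false)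

  split-merge : ∀ i b L → NonFixedAt (falsePositions i b) L →
    fixedMask i (merge i b L) ≡ b × nonFixedFrom i (merge i b L) ≡ L
  split-merge i [] [] [] = refl , refl
  split-merge i (true ∷ b) L nonFixed rewrite isFixed-refl i =
    let mask≡ , nonFixed≡ = split-merge (suc i) b L nonFixed in cong (true ∷_) mask≡ , nonFixed≡
  split-merge i (false ∷ b) (x ∷ L) (x-nonFixed ∷ nonFixed) rewrite x-nonFixed =
    let mask≡ , nonFixed≡ = split-merge (suc i) b L nonFixed in cong (false ∷_) mask≡ , cong (x ∷_) nonFixed≡

  length-fixedMask : ∀ i w → length (fixedMask i w) ≡ length w
  length-fixedMask i [] = refl
  length-fixedMask i (x ∷ w) = cong suc (length-fixedMask (suc i) w)

  length-nonFixedFrom : ∀ i w → length (nonFixedFrom i w) ≡ falses (fixedMask i w)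
  length-nonFixedFrom i [] = refl
  length-nonFixedFrom i (x ∷ w) with isFixed i x
  ... | true = length-nonFixedFrom (suc i) w
  ... | false = cong suc (length-nonFixedFrom (suc i) w)

  col-merge : ∀ i b L → falses b ≡ length L → col (merge i b L) ≡ col L
  col-merge i [] [] _ = refl
  col-merge i (true ∷ b) L eq = col-merge (suc i) b L eq
  col-merge i (false ∷ b) (x ∷ L) eq = cong (color x +_) (col-merge (suc i) b L (suc-injective eq))

  vals-merge-↭ : ∀ i b L → falses b ≡ length L → vals (merge i b L) ↭ truePositions i b ++ vals L
  vals-merge-↭ i [] [] _ = ↭-refl
  vals-merge-↭ i (true ∷ b) L eq = ↭-prep i (vals-merge-↭ (suc i) b L eq)
  vals-merge-↭ i (false ∷ b) (x ∷ L) eq =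
    ↭-trans (↭-prep (val x) (vals-merge-↭ (suc i) b L (suc-injective eq)))
            (↭-sym (shift (val x) (truePositions (suc i) b) (vals L)))

  merge-colors : ∀ {c} → 0 < c → ∀ i b L → All (λ x → color x < c) L → All (λ x → color x < c) (merge i b L)
  merge-colors 0<c i [] L _ = []
  merge-colors 0<c i (true ∷ b) L L< = 0<c ∷ merge-colors 0<c (suc i) b L L<
  merge-colors 0<c i (false ∷ b) [] _ = []
  merge-colors 0<c i (false ∷ b) (x ∷ L) (x< ∷ L<) = x< ∷ merge-colors 0<c (suc i) b L L<

  falsePositions-≥ : ∀ i b {p} → p ∈ falsePositions i b → i ≤ p
  falsePositions-≥ i (true ∷ b) p∈ = <⇒≤ (falsePositions-≥ (suc i) b p∈)
  falsePositions-≥ i (false ∷ b) (here refl) = ≤-refl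
  falsePositions-≥ i (false ∷ b) (there p∈) = <⇒≤ (falsePositions-≥ (suc i) b p∈)

  falsePositions-sorted : ∀ i b → Sorted (falsePositions i b)
  falsePositions-sorted i [] = []
  falsePositions-sorted i (true ∷ b) = falsePositions-sorted (suc i) b
  falsePositions-sorted i (false ∷ b) =
    All.tabulate (falsePositions-≥ (suc i) b) ∷ falsePositions-sorted (suc i) b

module ColoredPermutations where

  open import Defs using (Word; val; color; words; letters; notElem; distinct; G; D; hasNoFixed; isFixed; indexedFrom; _==W_)
  open ListPermutations
  open Comparisons using (T⇒≡true; ≡true⇒T)
  open Standardization using (vals)
  open import Data.Bool.Base using (Bool; true; false; T)
  open import Data.Nat.Base using (ℕ; zero; suc; _<_; _≡ᵇ_)
  open import Data.Nat.Properties using (suc-injective; ≡ᵇ⇒≡; ≡⇒≡ᵇ)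
  open import Data.Bool.Properties using (T-∧)
  open import Function.Bundles using (Equivalence)
  open import Data.Product.Base using (_×_; _,_; proj₁; proj₂)
  open import Data.List.Base using ([]; _∷_; _++_; map; length; filterᵇ; concatMap; cartesianProductWith; upTo)
  open import Data.List.Properties using (∷-injective; length-map; length-applyUpTo)
  open import Data.List.Membership.Propositional using (_∈_)
  open import Data.List.Membership.Propositional.Properties
    using ( ∈-cartesianProductWith⁺; ∈-cartesianProductWith⁻; ∈-upTo⁺; ∈-upTo⁻; ∈-applyUpTo⁺; ∈-applyUpTo⁻
          ; ∈-filter⁺; ∈-filter⁻; ∈-map⁺)
  open import Data.List.Relation.Unary.Any using (here)
  open import Data.List.Relation.Unary.All as All using (All; []; _∷_)
  import Data.List.Relation.Unary.All.Properties as All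
  open import Data.List.Relation.Unary.Unique.Propositional using (Unique; []; _∷_)
  import Data.List.Relation.Unary.Unique.Propositional.Properties as Unique
  open import Data.List.Relation.Binary.Permutation.Propositional using (_↭_; ↭-sym)
  open import Data.List.Relation.Binary.Permutation.Propositional.Properties using (∈-resp-↭; ↭-length)
  open import Function.Base using (_∘_)
  open import Relation.Binary.PropositionalEquality
  open import Relation.Nullary.Decidable using (T?)
  open import Relation.Nullary.Negation using (contradiction)

  private variable
    A B C : Set

  concatMap-map : ∀ (f : A → B → C) xs ys → concatMap (λ x → map (f x) ys) xs ≡ cartesianProductWith f xs ys
  concatMap-map f [] ys = refl
  concatMap-map f (x ∷ xs) ys = cong (map (f x) ys ++_) (concatMap-map f xs ys)

  ∈-letters⁻ : ∀ {c n v t} → (v , t) ∈ letters c n → v ∈ oneTo n × t < c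
  ∈-letters⁻ {c} {n} v,t∈
    with a , t′ , a∈ , t′∈ , refl ← ∈-cartesianProductWith⁻ (λ a t → suc a , t) (upTo n) (upTo c)
                                     (subst (_ ∈_) (concatMap-map (λ a t → suc a , t) (upTo n) (upTo c)) v,t∈) =
    ∈-applyUpTo⁺ suc (∈-upTo⁻ a∈) , ∈-upTo⁻ t′∈

  ∈-letters⁺ : ∀ {c n v t} → v ∈ oneTo n → t < c → (v , t) ∈ letters c n
  ∈-letters⁺ {c} {n} v∈ t<c with a , a<n , refl ← ∈-applyUpTo⁻ suc v∈ =
    subst (_ ∈_) (sym (concatMap-map (λ a t → suc a , t) (upTo n) (upTo c)))
      (∈-cartesianProductWith⁺ (λ a t → suc a , t) (∈-upTo⁺ a<n) (∈-upTo⁺ t<c))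

  letters-unique : ∀ c n → Unique (letters c n)
  letters-unique c n = subst Unique (sym (concatMap-map (λ a t → suc a , t) (upTo n) (upTo c)))
    (Unique.cartesianProductWith⁺ (λ a t → suc a , t) (λ eq → suc-injective (cong proj₁ eq) , cong proj₂ eq)
                                  (Unique.upTo⁺ n) (Unique.upTo⁺ c))

  ∈-words⁻ : ∀ alph m {w} → w ∈ words alph m → length w ≡ m × All (_∈ alph) w
  ∈-words⁻ alph zero (here refl) = refl , []
  ∈-words⁻ alph (suc m) w∈
    with x , w′ , x∈ , w′∈ , refl ← ∈-cartesianProductWith⁻ _∷_ alph (words alph m)
                                      (subst (_ ∈_) (concatMap-map _∷_ alph (words alph m)) w∈) =
    let length≡ , w′⊆ = ∈-words⁻ alph m w′∈ in cong suc length≡ , x∈ ∷ w′⊆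

  ∈-words⁺ : ∀ alph m {w} → length w ≡ m → All (_∈ alph) w → w ∈ words alph m
  ∈-words⁺ alph zero {[]} refl [] = here refl
  ∈-words⁺ alph (suc m) {x ∷ w} length≡ (x∈ ∷ w⊆) =
    subst (_ ∈_) (sym (concatMap-map _∷_ alph (words alph m)))
      (∈-cartesianProductWith⁺ _∷_ x∈ (∈-words⁺ alph m (suc-injective length≡) w⊆))

  words-unique : ∀ alph m → Unique alph → Unique (words alph m)
  words-unique alph zero _ = [] ∷ []
  words-unique alph (suc m) alph! = subst Unique (sym (concatMap-map _∷_ alph (words alph m)))
    (Unique.cartesianProductWith⁺ _∷_ ∷-injective alph! (words-unique alph m alph!))

  notElem⇒≢ : ∀ a as → notElem a as ≡ true → All (a ≢_) as
  notElem⇒≢ a [] _ = []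
  notElem⇒≢ a (b ∷ bs) eq with a ≡ᵇ b in a≡ᵇb
  ... | false = (λ a≡b → subst T a≡ᵇb (≡⇒≡ᵇ a b a≡b)) ∷ notElem⇒≢ a bs eq

  ≢⇒notElem : ∀ a as → All (a ≢_) as → notElem a as ≡ true
  ≢⇒notElem a [] [] = refl
  ≢⇒notElem a (b ∷ bs) (a≢b ∷ a≢bs) with a ≡ᵇ b in a≡ᵇb
  ... | false = ≢⇒notElem a bs a≢bs
  ... | true = contradiction (≡ᵇ⇒≡ a b (≡true⇒T a≡ᵇb)) a≢b

  distinct⇒Unique : ∀ as → distinct as ≡ true → Unique as
  distinct⇒Unique [] _ = []
  distinct⇒Unique (a ∷ as) eq with notElem a as in fresh
  ... | true = notElem⇒≢ a as fresh ∷ distinct⇒Unique as eq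

  Unique⇒distinct : ∀ {as} → Unique as → distinct as ≡ true
  Unique⇒distinct [] = refl
  Unique⇒distinct {a ∷ as} (a≢as ∷ as!) rewrite ≢⇒notElem a as a≢as = Unique⇒distinct as!

  ∈-G⁻ : ∀ {c n π} → π ∈ G c n → vals π ↭ oneTo n × All (λ x → color x < c) π
  ∈-G⁻ {c} {n} {π} π∈ with π∈words , distinct-vals ← ∈-filter⁻ (T? ∘ (λ w → distinct (vals w))) π∈ =
    ↭-oneTo n (distinct⇒Unique (vals π) (T⇒≡true distinct-vals))
              (All.map⁺ (All.map (proj₁ ∘ ∈-letters⁻ {c} {n}) π⊆))
            (trans (length-map val π) length≡) ,
    All.map (proj₂ ∘ ∈-letters⁻ {c} {n}) π⊆
    where
    length≡ : length π ≡ n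
    length≡ = proj₁ (∈-words⁻ (letters c n) n π∈words)
    π⊆ : All (_∈ letters c n) π
    π⊆ = proj₂ (∈-words⁻ (letters c n) n π∈words)

  ∈-G⁺ : ∀ {c n π} → vals π ↭ oneTo n → All (λ x → color x < c) π → π ∈ G c n
  ∈-G⁺ {c} {n} {π} vals↭ colors<c =
    ∈-filter⁺ (T? ∘ (λ w → distinct (vals w)))
      (∈-words⁺ (letters c n) n (trans (sym (length-map val π)) (trans (↭-length vals↭) (length-applyUpTo suc n)))
                (All.tabulate λ x∈ → ∈-letters⁺ (∈-resp-↭ vals↭ (∈-map⁺ val x∈)) (All.lookup colors<c x∈)))
      (≡true⇒T (Unique⇒distinct (Unique-resp-↭ (oneTo-unique n) (↭-sym vals↭))))

  G-unique : ∀ c n → Unique (G c n)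
  G-unique c n = Unique.filter⁺ (T? ∘ (λ w → distinct (vals w))) (words-unique (letters c n) n (letters-unique c n))

  NoFixedPoints : ℕ → Word → Set
  NoFixedPoints i w = All (λ p → isFixed (proj₁ p) (proj₂ p) ≡ false) (indexedFrom i w)

  ∈-D⁻ : ∀ {c k σ} → σ ∈ D c k → σ ∈ G c k × NoFixedPoints 1 σ
  ∈-D⁻ {c} {k} {σ} σ∈ with σ∈G , no-fixed ← ∈-filter⁻ (T? ∘ hasNoFixed) σ∈ =
    σ∈G , length≡0⇒none (λ p → isFixed (proj₁ p) (proj₂ p)) (indexedFrom 1 σ) (T⇒≡true no-fixed)
    where
    length≡0⇒none : ∀ {A : Set} (p : A → Bool) xs →
      (length (filterᵇ p xs) ≡ᵇ 0) ≡ true → All (λ x → p x ≡ false) xs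
    length≡0⇒none p [] _ = []
    length≡0⇒none p (x ∷ xs) eq with p x in px
    ... | false = px ∷ length≡0⇒none p xs eq

  ==W-refl : ∀ w → T (w ==W w)
  ==W-refl [] = _
  ==W-refl ((v , t) ∷ w) =
    Equivalence.from T-∧ (Equivalence.from T-∧ (≡⇒≡ᵇ v v refl , ≡⇒≡ᵇ t t refl) , ==W-refl w)

  ==W⇒≡ : ∀ w w′ → T (w ==W w′) → w ≡ w′
  ==W⇒≡ [] [] _ = refl
  ==W⇒≡ ((v , t) ∷ w) ((v′ , t′) ∷ w′) eq with head≡ , tail≡ ← Equivalence.to T-∧ eq
    with v≡ , t≡ ← Equivalence.to T-∧ head≡ =
    cong₂ _∷_ (cong₂ _,_ (≡ᵇ⇒≡ v v′ v≡) (≡ᵇ⇒≡ t t′ t≡)) (==W⇒≡ w w′ tail≡)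

module Excedances where

  open import Defs using (Letter; Word; val; isFixed; _<L_)
  open ListPermutations
  open Standardization
  open Comparisons
  open FixedPointDecomposition
  open ColoredPermutations using (NoFixedPoints)
  open MajorIndex
  open FixedPointInsertion using (Token; letter; end; _▷_; mergeᵗ; IsLetter; Compatible; compatible-end)
  open Masks using (falses)
  open import Data.Bool.Base using (Bool; true; false; not; _∧_)
  open import Data.Nat.Base using (ℕ; zero; suc; _+_; _∸_; _<_; _≤_; _<ᵇ_; _≡ᵇ_; s≤s; z≤n)
  open import Data.Nat.Properties
  open import Data.Product.Base using (_×_; _,_; proj₁; proj₂)
  open import Data.List.Base using (List; []; _∷_; _++_; _∷ʳ_; map; length)
  open import Data.List.Properties using (length-++; ++-assoc)
  open import Data.List.Membership.Propositional using (_∈_)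
  open import Data.List.Relation.Unary.All as All using (All; []; _∷_)
  import Data.List.Relation.Unary.All.Properties as All
  open import Data.List.Relation.Binary.Pointwise using ([]; _∷_)
  open import Data.List.Relation.Unary.Linked using (Linked; [-]; _∷_)
  open import Data.Sum.Base using (_⊎_; inj₁; inj₂)
  open import Relation.Binary.PropositionalEquality
  open import Function.Base using (_∘_)
  open import Relation.Nullary.Decidable using (yes; no)

  isExcedance : ℕ → Letter → Bool
  isExcedance i (v , t) = (t ≡ᵇ 0) ∧ (i <ᵇ v)

  marked : ℕ → Word → List Token
  marked i [] = []
  marked i (x ∷ σ) = letter x (isExcedance i x) ∷ marked (suc i) σ

  record Cursor (P : List ℕ) (i j : ℕ) (b : List Bool) : Set where
    constructor cursor
    field
      before : List ℕ
      split : P ≡ before ++ falsePositions i b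
      before< : All (_< i) before
      length-before : length before ≡ j

  start : ∀ b → Cursor (falsePositions 1 b) 1 0 b
  start b = cursor [] refl [] refl

  skip-fixed : ∀ {P i j b} → Cursor P i j (true ∷ b) → Cursor P (suc i) j b
  skip-fixed (cursor before split before< length-before) =
    cursor before split (All.map m<n⇒m<1+n before<) length-before

  skip-nonFixed : ∀ {P i j b} → Cursor P i j (false ∷ b) → Cursor P (suc i) (suc j) b
  skip-nonFixed {i = i} {b = b} (cursor before refl before< refl) =
    cursor (before ∷ʳ i) (sym (++-assoc before (i ∷ []) (falsePositions (suc i) b)))
           (All.∷ʳ⁺ (All.map m<n⇒m<1+n before<) ≤-refl)
           (trans (length-++ before) (+-comm _ 1))

  nonFixed-position : ∀ {P i j b} → Cursor P i j (false ∷ b) → j < length P × nth P j ≡ i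
  nonFixed-position {i = i} {b = b} (cursor before refl _ refl) =
    subst (length before <_) (sym (length-++ before)) (m<m+n (length before) (s≤s z≤n)) ,
    trans (cong (nth (before ++ falsePositions i (false ∷ b))) (sym (+-identityʳ (length before))))
          (nth-++ʳ before (falsePositions i (false ∷ b)) 0)

  fixed-position : ∀ {P i j b} → Cursor P i j (true ∷ b) →
    ∀ {w} → w < length P → (nth P w <ᵇ i) ≡ (w <ᵇ j) × nth P w ≢ i
  fixed-position {i = i} {b = b} (cursor before refl before< refl) {w} w< with w <? length before
  ... | yes w<j = trans (<ᵇ-true below) (sym (<ᵇ-true w<j)) , <⇒≢ below
    where
    below : nth (before ++ falsePositions (suc i) b) w < i
    below = subst (_< i) (sym (nth-++ˡ before _ w<j)) (All.lookup before< (nth-∈ before w<j))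
  ... | no w≮j = trans (<ᵇ-false (<⇒≤ above)) (sym (<ᵇ-false (≮⇒≥ w≮j))) , λ eq → <⇒≢ above (sym eq)
    where
    after : List ℕ
    after = falsePositions (suc i) b
    w≡ : length before + (w ∸ length before) ≡ w
    w≡ = m+[n∸m]≡n (≮⇒≥ w≮j)
    u< : w ∸ length before < length after
    u< = +-cancelˡ-< (length before) _ _ (subst (_< length before + length after) (sym w≡) (subst (w <_) (length-++ before) w<))
    above : i < nth (before ++ after) w
    above = subst (i <_) (trans (sym (nth-++ʳ before after (w ∸ length before))) (cong (nth (before ++ after)) w≡))
                  (falsePositions-≥ (suc i) b (nth-∈ after u<))

  InRange : ℕ → Letter → Set
  InRange k x = val x ∈ oneTo k

  relabel-isFixed : ∀ {P} → Sorted P → ∀ {j} → j < length P → ∀ x → InRange (length P) x →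
    isFixed (nth P j) (relabel P x) ≡ isFixed (suc j) x
  relabel-isFixed P-sorted j< (v , t) v∈ with ∈-oneTo⁻ v∈
  relabel-isFixed {P} P-sorted j< (suc v , t) v∈ | _ , v< =
    cong (_∧ (t ≡ᵇ 0)) (≡ᵇ-cmp (nth-injective P-sorted v< j<) (cong (nth P)))

  fixed-fixed : ∀ i → ((suc i , 0) <L (i , 0)) ≡ false
  fixed-fixed i = <ᵇ-false (n≤1+n i)

  fixed-letter : ∀ {P i j b} → Cursor P i j (true ∷ b) → ∀ y → InRange (length P) y → isFixed (suc j) y ≡ false →
    (relabel P y <L (i , 0)) ≡ not (isExcedance (suc j) y)
  fixed-letter κ (v , t) v∈ _ with ∈-oneTo⁻ v∈
  fixed-letter κ (suc v , suc t) _ _ | _ = refl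
  fixed-letter {j = j} κ (suc v , zero) _ y-nonFixed | _ , v< =
    trans (proj₁ (fixed-position κ v<)) (<ᵇ-flip {v} {j} (isFixed⇒≢ y-nonFixed ∘ cong suc))

  letter-fixed : ∀ {P i j b} → Cursor P (suc i) (suc j) (true ∷ b) → ∀ x → InRange (length P) x →
    ((suc i , 0) <L relabel P x) ≡ isExcedance (suc j) x
  letter-fixed κ (v , t) v∈ with ∈-oneTo⁻ v∈
  letter-fixed κ (suc v , suc t) _ | _ = refl
  letter-fixed {i = i} {j} κ (suc v , zero) _ | _ , v< =
    trans (<ᵇ-flip (λ eq → proj₂ (fixed-position κ v<) (sym eq)))
          (trans (cong not (proj₁ (fixed-position κ v<))) (not-<ᵇ-suc v j))

  letter-letter : ∀ {P} → Sorted P → ∀ x y → InRange (length P) x → InRange (length P) y →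
    (relabel P y <L relabel P x) ≡ (y <L x)
  letter-letter P-sorted (vx , tx) (vy , ty) vx∈ vy∈ with ∈-oneTo⁻ vx∈ | ∈-oneTo⁻ vy∈
  letter-letter P-sorted (suc vx , tx) (suc vy , ty) _ _ | _ , vx< | _ , vy<
    rewrite nth-monoᵇ P-sorted vy< vx< = refl

  relabel-NonFixedAt : ∀ {P} → Sorted P → ∀ {i j b σ} → Cursor P i j b → falses b ≡ length σ →
    NoFixedPoints (suc j) σ → All (InRange (length P)) σ → NonFixedAt (falsePositions i b) (map (relabel P) σ)
  relabel-NonFixedAt P-sorted {b = []} {[]} κ _ _ _ = []
  relabel-NonFixedAt P-sorted {b = true ∷ b} κ falses≡ σ-nonFixed σ-inRange =
    relabel-NonFixedAt P-sorted (skip-fixed κ) falses≡ σ-nonFixed σ-inRange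
  relabel-NonFixedAt {P} P-sorted {b = false ∷ b} {σ = x ∷ σ} κ falses≡
                     (x-nonFixed ∷ σ-nonFixed) (x-inRange ∷ σ-inRange)
    with j< , nth≡i ← nonFixed-position κ =
    trans (cong (λ i → isFixed i (relabel P x)) (sym nth≡i)) (trans (relabel-isFixed P-sorted j< x x-inRange) x-nonFixed)
    ∷ relabel-NonFixedAt P-sorted (skip-nonFixed κ) (suc-injective falses≡) σ-nonFixed σ-inRange

  relabel-descents : ∀ {P} → Sorted P → ∀ {i j b σ} → Cursor P i j b → falses b ≡ length σ →
    NoFixedPoints (suc j) σ → All (InRange (length P)) σ →
    descents letterDescent (merge i b (map (relabel P) σ)) ≡ descents _▷_ (mergeᵗ b (marked (suc j) σ))
  relabel-descents P-sorted {b = []} {[]} κ _ _ _ = refl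
  relabel-descents P-sorted {b = true ∷ []} {[]} κ _ _ _ = refl
  relabel-descents P-sorted {i = i} {b = true ∷ true ∷ b} κ falses≡ σ-nonFixed σ-inRange =
    cong₂ _∷_ (fixed-fixed i) (relabel-descents P-sorted (skip-fixed κ) falses≡ σ-nonFixed σ-inRange)
  relabel-descents P-sorted {b = true ∷ false ∷ b} {σ = y ∷ σ} κ falses≡
                   σ-nonFixed@(y-nonFixed ∷ _) σ-inRange@(y-inRange ∷ _) =
    cong₂ _∷_ (fixed-letter κ y y-inRange y-nonFixed) (relabel-descents P-sorted (skip-fixed κ) falses≡ σ-nonFixed σ-inRange)
  relabel-descents P-sorted {b = false ∷ []} {σ = x ∷ []} κ _ _ _ = refl
  relabel-descents P-sorted {b = false ∷ true ∷ b} {σ = x ∷ σ} κ falses≡ (_ ∷ σ-nonFixed) (x-inRange ∷ σ-inRange) =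
    cong₂ _∷_ (letter-fixed (skip-nonFixed κ) x x-inRange)
              (relabel-descents P-sorted (skip-nonFixed κ) (suc-injective falses≡) σ-nonFixed σ-inRange)
  relabel-descents P-sorted {b = false ∷ false ∷ b} {σ = x ∷ y ∷ σ} κ falses≡
                   (_ ∷ σ-nonFixed) (x-inRange ∷ σ-inRange@(y-inRange ∷ _)) =
    cong₂ _∷_ (letter-letter P-sorted x y x-inRange y-inRange)
              (relabel-descents P-sorted (skip-nonFixed κ) (suc-injective falses≡) σ-nonFixed σ-inRange)

  descents-marked : ∀ i σ → descents _▷_ (marked i σ) ≡ descents letterDescent σ
  descents-marked i [] = refl
  descents-marked i (x ∷ []) = refl
  descents-marked i (x ∷ y ∷ σ) = cong (y <L x ∷_) (descents-marked (suc i) (y ∷ σ))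

  length-marked : ∀ i σ → length (marked i σ) ≡ length σ
  length-marked i [] = refl
  length-marked i (x ∷ σ) = cong suc (length-marked (suc i) σ)

  marked-letters : ∀ i σ → All IsLetter (marked i σ)
  marked-letters i [] = []
  marked-letters i (x ∷ σ) = _ ∷ marked-letters (suc i) σ

  private
    one-compatible : ∀ d → (1 ≡ ⟦ d ⟧) ⊎ (1 ≡ suc ⟦ d ⟧)
    one-compatible true = inj₁ refl
    one-compatible false = inj₂ refl

  -- An excedance followed by a non-excedance is a descent; a non-excedance followed by an excedance is not.
  excedances-compatible : ∀ i x y → isFixed (suc i) y ≡ false →
    Compatible (letter x (isExcedance i x)) (letter y (isExcedance (suc i) y))
  excedances-compatible i (vx , suc tx) (vy , suc ty) _ = one-compatible _
  excedances-compatible i (vx , suc tx) (vy , zero) _ with suc i <ᵇ vy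
  ... | true = inj₁ refl
  ... | false = inj₂ refl
  excedances-compatible i (vx , zero) (vy , suc ty) _ with i <ᵇ vx
  ... | true = inj₂ refl
  ... | false = inj₁ refl
  excedances-compatible i (vx , zero) (vy , zero) y-nonFixed with i <ᵇ vx in exc-x | suc i <ᵇ vy in exc-y
  ... | true | true = one-compatible _
  ... | false | false = one-compatible _
  ... | true | false = inj₂ (cong (suc ∘ ⟦_⟧) (sym (<ᵇ-true {vy} {vx} vy<vx)))
    where
    vy<vx : vy < vx
    vy<vx = ≤-<-trans (≤-pred (≤∧≢⇒< (<ᵇ-false⁻ exc-y) (isFixed⇒≢ y-nonFixed))) (<ᵇ-true⁻ exc-x)
  ... | false | true = inj₁ (cong ⟦_⟧ (sym (<ᵇ-false {vy} {vx} vx≤vy)))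
    where
    vx≤vy : vx ≤ vy
    vx≤vy = <⇒≤ (≤-<-trans (<ᵇ-false⁻ exc-x) (<-trans (n<1+n i) (<ᵇ-true⁻ exc-y)))

  marked-compatible : ∀ i σ → NoFixedPoints i σ → Linked Compatible (marked i σ ∷ʳ end)
  marked-compatible i [] _ = [-]
  marked-compatible i (x ∷ []) _ = compatible-end (letter x (isExcedance i x)) _ ∷ [-]
  marked-compatible i (x ∷ y ∷ σ) (_ ∷ σ-nonFixed@(y-nonFixed ∷ _)) =
    excedances-compatible i x y y-nonFixed ∷ marked-compatible (suc i) (y ∷ σ) σ-nonFixed

open Polynomials
open GeneratingFunctions
open GaussianCoefficients
open Masks
open MajorIndex
open FixedPointInsertion
open ListPermutations
open Standardization
open Comparisons
open FixedPointDecomposition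
open ColoredPermutations
open Excedances
open import Data.Bool.Base using (Bool; T)
open import Algebra.Bundles using (CommutativeSemiring)
open import Algebra.Properties.CommutativeSemigroup (CommutativeSemiring.*-commutativeSemigroup commutativeSemiring)
  using (x∙yz≈y∙xz)
open import Data.Nat.Base using (ℕ; suc; pred; _+_; _*_; _∸_; _≤_; _<_; _≡ᵇ_)
open import Data.Nat.Properties using (m+[n∸m]≡n; +-comm; +-identityʳ; +-cancelˡ-≡)
open import Data.Product.Base using (_×_; _,_; proj₁; proj₂)
open import Data.List.Base using (List; _++_; _∷ʳ_; map; length; filterᵇ)
open import Data.List.Properties using (map-∘; length-map; map-id-local; length-applyUpTo)
open import Data.List.Membership.Propositional using (_∈_)
open import Data.List.Membership.Propositional.Properties using (∈-map⁺; ∈-map⁻; ∈-filter⁺; ∈-filter⁻)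
open import Data.List.Relation.Unary.All as All using (All)
import Data.List.Relation.Unary.All.Properties as All
open import Data.List.Relation.Unary.Unique.Propositional using (Unique)
import Data.List.Relation.Unary.Unique.Propositional.Properties as Unique
open import Data.List.Relation.Binary.Permutation.Propositional using (_↭_)
import Data.List.Relation.Binary.Permutation.Propositional.Properties as ↭
open import Data.List.Relation.Binary.Permutation.Propositional using (module PermutationReasoning)
open import Function.Base using (_∘_)
open import Relation.Binary.PropositionalEquality
open import Relation.Nullary.Decidable using (T?)

module Fibre {c n k} (0<c : 0 < c) (k≤n : k ≤ n) {σ} (σ∈D : σ ∈ D c k) where

  r : ℕ
  r = n ∸ k

  k+r≡n : k + r ≡ n
  k+r≡n = m+[n∸m]≡n k≤n

  σ∈G : σ ∈ G c k
  σ∈G = proj₁ (∈-D⁻ {c} {k} σ∈D)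

  σ-nonFixed : NoFixedPoints 1 σ
  σ-nonFixed = proj₂ (∈-D⁻ {c} {k} σ∈D)

  σ-vals : vals σ ↭ oneTo k
  σ-vals = proj₁ (∈-G⁻ {c} {k} σ∈G)

  σ-colors : All (λ x → color x < c) σ
  σ-colors = proj₂ (∈-G⁻ {c} {k} σ∈G)

  length-σ : length σ ≡ k
  length-σ = trans (sym (length-map val σ)) (trans (↭.↭-length σ-vals) (length-applyUpTo suc k))

  σ-inRange : All (InRange k) σ
  σ-inRange = All.tabulate (λ x∈ → ↭.∈-resp-↭ σ-vals (∈-map⁺ val x∈))

  A : List Token
  A = marked 1 σ

  realize : List Bool → Word
  realize b = merge 1 b (map (relabel (falsePositions 1 b)) σ)

  module Realization (b : List Bool) (falses≡k : falses b ≡ k) where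

    P : List ℕ
    P = falsePositions 1 b

    length-P : length P ≡ k
    length-P = trans (length-falsePositions 1 b) falses≡k

    P-sorted : Sorted P
    P-sorted = falsePositions-sorted 1 b

    L : Word
    L = map (relabel P) σ

    falses≡length-σ : falses b ≡ length σ
    falses≡length-σ = trans falses≡k (sym length-σ)

    falses≡length-L : falses b ≡ length L
    falses≡length-L = trans falses≡length-σ (sym (length-map (relabel P) σ))

    σ-inRange-P : All (InRange (length P)) σ
    σ-inRange-P = subst (λ m → All (InRange m) σ) (sym length-P) σ-inRange

    realize-split : fixedMask 1 (realize b) ≡ b × nonFixedFrom 1 (realize b) ≡ L
    realize-split = split-merge 1 b L (relabel-NonFixedAt P-sorted (start b) falses≡length-σ σ-nonFixed σ-inRange-P)

    dp-realize : dp (realize b) ≡ σ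
    dp-realize = trans (cong standardize (trans (nonFixedFrom-indexed 1 (realize b)) (proj₂ realize-split)))
                       (standardize-relabel σ P-sorted (subst (λ m → vals σ ↭ oneTo m) (sym length-P) σ-vals))

    fmaj-realize : fmaj c (realize b) ≡ col σ + c * tmaj (mergeᵗ b A ∷ʳ end)
    fmaj-realize = trans (cong₂ (λ m l → c * m + l) maj≡ col≡) (+-comm (c * tmaj (mergeᵗ b A ∷ʳ end)) (col σ))
      where
      maj≡ : maj (realize b) ≡ tmaj (mergeᵗ b A ∷ʳ end)
      maj≡ = trans (majFrom-descents 1 (realize b))
            (trans (cong (positionSum 1) (relabel-descents P-sorted (start b) falses≡length-σ σ-nonFixed σ-inRange-P))
                   (sym (tmaj-end (mergeᵗ b A))))
      col≡ : col (realize b) ≡ col σ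
      col≡ = trans (col-merge 1 b L falses≡length-L) (col-relabel P σ)

    realize-vals : vals (realize b) ↭ oneTo (length b)
    realize-vals = begin
      vals (merge 1 b L)                        ↭⟨ vals-merge-↭ 1 b L falses≡length-L ⟩
      truePositions 1 b ++ vals L               ≡⟨ cong (truePositions 1 b ++_) (vals-relabel P σ) ⟩
      truePositions 1 b ++ map (nth P ∘ pred) (vals σ)
        ↭⟨ ↭.++⁺ˡ (truePositions 1 b)
                  (↭.map⁺ (nth P ∘ pred) (subst (λ m → vals σ ↭ oneTo m) (sym length-P) σ-vals)) ⟩
      truePositions 1 b ++ map (nth P ∘ pred) (oneTo (length P))
                                                ≡⟨ cong (truePositions 1 b ++_) (map-nth-oneTo P) ⟩
      truePositions 1 b ++ P                    ↭⟨ positions-↭ 1 b ⟩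
      oneTo (length b)                          ∎
      where open PermutationReasoning

    realize∈G : length b ≡ n → realize b ∈ G c n
    realize∈G refl = ∈-G⁺ realize-vals (merge-colors 0<c 1 b L (All.map⁺ σ-colors))

  fibre : List Word
  fibre = filterᵇ (λ π → dp π ==W σ) (G c n)

  realize∈fibre : ∀ {b} → b ∈ masks k r → realize b ∈ fibre
  realize∈fibre {b} b∈ with falses≡k , trues≡r ← ∈-masks⁻ b∈ =
    ∈-filter⁺ (T? ∘ (λ π → dp π ==W σ)) (realize∈G length-b)
              (subst (λ w → T (w ==W σ)) (sym dp-realize) (==W-refl σ))
    where
    open Realization b falses≡k
    length-b : length b ≡ n
    length-b = trans (sym (falses+trues b)) (trans (cong₂ _+_ falses≡k trues≡r) k+r≡n)

  module Decomposition {π} (π∈G : π ∈ G c n) (dp≡σ : dp π ≡ σ) where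

    b : List Bool
    b = fixedMask 1 π

    NV : Word
    NV = nonFixedFrom 1 π

    π-vals : vals π ↭ oneTo n
    π-vals = proj₁ (∈-G⁻ {c} {n} π∈G)

    standardize-NV : standardize NV ≡ σ
    standardize-NV = trans (cong standardize (sym (nonFixedFrom-indexed 1 π))) dp≡σ

    falses≡length-NV : falses b ≡ length NV
    falses≡length-NV = sym (length-nonFixedFrom 1 π)

    falses≡k : falses b ≡ k
    falses≡k = trans falses≡length-NV (trans (sym (length-map _ NV)) (trans (cong length standardize-NV) length-σ))

    length-b : length b ≡ n
    length-b = trans (length-fixedMask 1 π)
      (trans (sym (length-map val π)) (trans (↭.↭-length π-vals) (length-applyUpTo suc n)))

    trues≡r : trues b ≡ r
    trues≡r = +-cancelˡ-≡ k (trues b) r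
      (trans (cong (_+ trues b) (sym falses≡k)) (trans (falses+trues b) (trans length-b (sym k+r≡n))))

    NV-vals : vals NV ↭ falsePositions 1 b
    NV-vals = ++-cancelˡ-↭ (truePositions 1 b) (begin
      truePositions 1 b ++ vals NV   ↭⟨ vals-merge-↭ 1 b NV falses≡length-NV ⟨
      vals (merge 1 b NV)            ≡⟨ cong vals (merge-split 1 π) ⟩
      vals π                         ↭⟨ π-vals ⟩
      oneTo n                        ≡⟨ cong oneTo length-b ⟨
      oneTo (length b)               ↭⟨ positions-↭ 1 b ⟨
      truePositions 1 b ++ falsePositions 1 b ∎)
      where open PermutationReasoning

    π≡realize : π ≡ realize b
    π≡realize = trans (sym (merge-split 1 π)) (cong (merge 1 b) (begin
      NV                                                       ≡⟨ relabel-standardize NV (falsePositions-sorted 1 b) NV-vals ⟨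
      map (relabel (falsePositions 1 b)) (standardize NV)      ≡⟨ cong (map (relabel (falsePositions 1 b))) standardize-NV ⟩
      map (relabel (falsePositions 1 b)) σ                     ∎))
      where open ≡-Reasoning

  fibre⊆realize : ∀ {π} → π ∈ fibre → fixedMask 1 π ∈ masks k r × π ≡ realize (fixedMask 1 π)
  fibre⊆realize {π} π∈ with π∈G , dp==σ ← ∈-filter⁻ (T? ∘ (λ π → dp π ==W σ)) {xs = G c n} π∈ =
    ∈-masks⁺ b falses≡k trues≡r , π≡realize
    where open Decomposition π∈G (==W⇒≡ (dp π) σ dp==σ)

  realize-unique : Unique (map realize (masks k r))
  realize-unique = Unique.map⁻ {f = fixedMask 1} (subst Unique (sym mask∘realize) (masks-unique k r))
    where
    mask∘realize : map (fixedMask 1) (map realize (masks k r)) ≡ masks k r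
    mask∘realize = trans (sym (map-∘ (masks k r)))
      (map-id-local (All.tabulate (λ b∈ → proj₁ (Realization.realize-split _ (proj₁ (∈-masks⁻ b∈))))))

  fibre-↭ : fibre ↭ map realize (masks k r)
  fibre-↭ = unique∧same⇒↭ (Unique.filter⁺ (T? ∘ (λ π → dp π ==W σ)) (G-unique c n)) realize-unique
    (λ π∈ → let b∈ , π≡ = fibre⊆realize π∈ in subst (_∈ map realize (masks k r)) (sym π≡) (∈-map⁺ realize b∈))
    (λ π∈ → let _ , b∈ , π≡ = ∈-map⁻ realize π∈ in subst (_∈ fibre) (sym π≡) (realize∈fibre b∈))

  maj-marked : tmaj (A ∷ʳ end) ≡ maj σ
  maj-marked = trans (tmaj-end A) (trans (cong (positionSum 1) (descents-marked 1 σ)) (sym (majFrom-descents 1 σ)))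

  gf-fibre : gf fibre (fmaj c) ≈ mono (fmaj c σ) ⊗ qbinom c k r
  gf-fibre = begin
    gf fibre (fmaj c)
      ≈⟨ gf-↭ (fmaj c) fibre-↭ ⟩
    gf (map realize (masks k r)) (fmaj c)
      ≈⟨ gf-map realize (masks k r) (fmaj c) ⟩
    gf (masks k r) (fmaj c ∘ realize)
      ≈⟨ gf-cong (λ {b} b∈ → Realization.fmaj-realize b (proj₁ (∈-masks⁻ b∈))) ⟩
    gf (masks k r) (λ b → col σ + c * tmaj (mergeᵗ b A ∷ʳ end))
      ≈⟨ gf-+ (masks k r) (col σ) _ ⟩
    mono (col σ) ⊗ gf (masks k r) (λ b → c * tmaj (mergeᵗ b A ∷ʳ end))
      ≈⟨ ⊗-congˡ (mono (col σ)) (gf-insertions c k r A end (trans (length-marked 1 σ) length-σ) (marked-letters 1 σ)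
                                                     (marked-compatible 1 σ σ-nonFixed)) ⟩
    mono (col σ) ⊗ (mono (c * (tmaj (A ∷ʳ end) + 0)) ⊗ qbinom c k r)
      ≈⟨ ⊗-assoc (mono (col σ)) (mono (c * (tmaj (A ∷ʳ end) + 0))) (qbinom c k r) ⟨
    (mono (col σ) ⊗ mono (c * (tmaj (A ∷ʳ end) + 0))) ⊗ qbinom c k r
      ≈⟨ ⊗-congʳ (qbinom c k r) (mono-+ (col σ) (c * (tmaj (A ∷ʳ end) + 0))) ⟩
    mono (col σ + c * (tmaj (A ∷ʳ end) + 0)) ⊗ qbinom c k r
      ≡⟨ cong (λ e → mono e ⊗ qbinom c k r) exponent ⟩
    mono (fmaj c σ) ⊗ qbinom c k r
      ∎
    where
    open ≈-Reasoning
    exponent : col σ + c * (tmaj (A ∷ʳ end) + 0) ≡ c * maj σ + col σ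
    exponent = trans (+-comm (col σ) _) (cong (λ e → c * e + col σ) (trans (+-identityʳ _) maj-marked))

dpGen≡gf : ∀ c n σ m → dpGen c n σ m ≡ gf (filterᵇ (λ π → dp π ==W σ) (G c n)) (fmaj c) m
dpGen≡gf c n σ m = trans (cong length (filterᵇ-∧ (λ π → dp π ==W σ) (λ π → fmaj c π ≡ᵇ m) (G c n)))
                         (gf-coefficient (filterᵇ (λ π → dp π ==W σ) (G c n)) (fmaj c) m)

corollary2p9 : (c n k : ℕ) → 1 ≤ c → k ≤ n → (σ : Word) → σ ∈ D c k →
    (m : ℕ) →
    ((qfact c k ⊗ qfact c (n ∸ k)) ⊗ dpGen c n σ) m ≡ (mono (fmaj c σ) ⊗ qfact c n) m
corollary2p9 c n k 1≤c k≤n σ σ∈D = coeff (begin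
  (qfact c k ⊗ qfact c r) ⊗ dpGen c n σ
    ≈⟨ ⊗-congˡ (qfact c k ⊗ qfact c r) (coeffwise (dpGen≡gf c n σ)) ⟩
  (qfact c k ⊗ qfact c r) ⊗ gf fibre (fmaj c)
    ≈⟨ ⊗-congˡ (qfact c k ⊗ qfact c r) gf-fibre ⟩
  (qfact c k ⊗ qfact c r) ⊗ (mono (fmaj c σ) ⊗ qbinom c k r)
    ≈⟨ x∙yz≈y∙xz (qfact c k ⊗ qfact c r) (mono (fmaj c σ)) (qbinom c k r) ⟩
  mono (fmaj c σ) ⊗ ((qfact c k ⊗ qfact c r) ⊗ qbinom c k r)
    ≈⟨ ⊗-congˡ (mono (fmaj c σ)) (qfact-qbinom c k r) ⟩
  mono (fmaj c σ) ⊗ qfact c (k + r)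
    ≡⟨ cong (λ l → mono (fmaj c σ) ⊗ qfact c l) k+r≡n ⟩
  mono (fmaj c σ) ⊗ qfact c n
    ∎)
  where
  open Fibre 1≤c k≤n σ∈D
  open ≈-Reasoning
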